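{- Let $\mu_1,\dots,\mu_e\in X(T)$ with $\mu_i-\rho$ dominant for each $i$, and suppose that $$\operatorname{ch}\Big(\bigotimes_{i=1}^eH^0(\mu_i-\rho)\Big)=\sum_{\lambda\in X(T)}m(\lambda,\mu)\operatorname{ch}H^0(\lambda)$$ for integers $m(\lambda,\mu)$ (finitely many nonzero, $\lambda$ dominant). Then $$\dim\Big(\bigotimes_{i=1}^eH^0(n\mu_i)\Big)-\sum_\lambda m(\lambda,\mu)\dim H^0(n(\lambda+\rho))\dim\big(H^0(n\rho)^{\otimes(e-1)}\big)$$ is a polynomial in $n$ of degree $<\sum_i\dim G/P_{\mu_i}$.
   Context: $G=\operatorname{GL}_d$ over a field $K$ of characteristic zero, $T$ the diagonal torus, $X(T)=\mathbb{Z}^d$, dominant means $\lambda_1\ge\dots\ge\lambda_d$, $\rho=(d-1,\dots,1,0)$. For dominant $\lambda$, $H^0(\lambda)$ is the irreducible algebraic representation of highest weight $\lambda$ and $P_\lambda$ the parabolic subgroup stabilising $\lambda$ (so $\dim G/P_\lambda$ is the number of pairs $i<j$ with $\lambda_i\ne\lambda_j$). $\operatorname{ch}(V)=\sum_\lambda\dim V_\lambda\,e(\lambda)\in\mathbb{Z}[X(T)]$ is the formal character. -}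

module Defs where

open import Data.Nat as ℕ using (ℕ; zero; suc)
open import Data.Integer as ℤ using (ℤ; +_)
open import Data.Rational as ℚ using (ℚ)
open import Data.Fin as Fin using (Fin; toℕ)
open import Data.Vec as Vec using (Vec; []; _∷_; lookup; tabulate; zipWith)
open import Data.Vec.Properties using (≡-dec)
open import Data.List as List using (List; []; _∷_; map; concatMap; foldr; replicate; allFin; upTo)
open import Data.Product using (_×_; _,_; proj₁; proj₂)
open import Data.Nat.ListAction using (sum)
open import Data.Bool using (if_then_else_)
open import Relation.Nullary using (does; yes; no)
open import Relation.Nullary.Decidable using (_×-dec_; ¬?)

-- Weights of the diagonal torus of GL_d : X(T) = ℤ^d
Weight : ℕ → Set
Weight d = Vec ℤ d

-- Elements of ℤ[X(T)], represented as finite formal sums  Σ c · e(w)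
-- (a list of pairs (w , c); repetitions allowed, meaning is the coefficient function below).
FormalChar : ℕ → Set
FormalChar d = List (Weight d × ℤ)

coeff : ∀ {d} → FormalChar d → Weight d → ℤ
coeff {d} χ ν = foldr (λ wc acc → (if does (≡-dec ℤ._≟_ (proj₁ wc) ν) then proj₂ wc else + 0) ℤ.+ acc) (+ 0) χ

_⊕_ : ∀ {d} → FormalChar d → FormalChar d → FormalChar d
_⊕_ = List._++_

scaleC : ∀ {d} → ℤ → FormalChar d → FormalChar d
scaleC c = map (λ wc → proj₁ wc , c ℤ.* proj₂ wc)

_⊗_ : ∀ {d} → FormalChar d → FormalChar d → FormalChar d
χ ⊗ ψ = concatMap (λ a → map (λ b → zipWith ℤ._+_ (proj₁ a) (proj₁ b) , proj₂ a ℤ.* proj₂ b) ψ) χ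

zeroW : ∀ {d} → Weight d
zeroW = Vec.replicate _ (+ 0)

oneC : ∀ {d} → FormalChar d
oneC = (zeroW , + 1) ∷ []

⊗all : ∀ {d} → List (FormalChar d) → FormalChar d
⊗all = foldr _⊗_ oneC

dimC : ∀ {d} → FormalChar d → ℤ
dimC = foldr (λ wc acc → proj₂ wc ℤ.+ acc) (+ 0)

_+w_ : ∀ {d} → Weight d → Weight d → Weight d
_+w_ = zipWith ℤ._+_

_-w_ : ∀ {d} → Weight d → Weight d → Weight d
_-w_ = zipWith ℤ._-_

_·w_ : ∀ {d} → ℕ → Weight d → Weight d
n ·w v = Vec.map (λ x → + n ℤ.* x) v

ρ : (d : ℕ) → Weight d
ρ d = tabulate (λ i → + (d ℕ.∸ 1 ℕ.∸ toℕ i))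

Dominant : ∀ {d} → Weight d → Set
Dominant {d} v = (i j : Fin d) → i Fin.≤ j → lookup v j ℤ.≤ lookup v i

dimGP : ∀ {d} → Weight d → ℕ
dimGP {d} v = sum (concatMap (λ i → map (λ j →
  if does ((toℕ i ℕ.<? toℕ j) ×-dec ¬? (lookup v i ℤ.≟ lookup v j)) then 1 else 0) (allFin d)) (allFin d))

rangeℤ : ℤ → ℤ → List ℤ
rangeℤ lo hi with lo ℤ.≤? hi
... | yes _ = map (λ k → lo ℤ.+ + k) (upTo (suc ℤ.∣ hi ℤ.- lo ∣))
... | no _  = []

interlace : ∀ {k} → Vec ℤ (suc k) → List (Vec ℤ k)
interlace {zero} (a ∷ []) = [] ∷ []
interlace {suc k} (a ∷ b ∷ r) = concatMap (λ m → map (m ∷_) (interlace (b ∷ r))) (rangeℤ b a)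

sumV : ∀ {k} → Vec ℤ k → ℤ
sumV = Vec.foldr _ ℤ._+_ (+ 0)

-- ch H^0(λ) for dominant λ, via Gelfand–Tsetlin patterns (branching rule GL_{d-1} ⊂ GL_d):
--   ch_d H^0(λ) = Σ_{μ interlacing λ} ch_{d-1} H^0(μ) · x_d^{|λ|-|μ|}
chH : (d : ℕ) → Weight d → FormalChar d
chH zero [] = oneC
chH (suc k) lam = concatMap (λ μ → map (λ wc → (proj₁ wc Vec.∷ʳ (sumV lam ℤ.- sumV μ)) , proj₂ wc) (chH k μ)) (interlace lam)

-- evaluation of a polynomial with rational coefficients (constant term first) at n
evalPoly : List ℚ → ℕ → ℚ
evalPoly p n = foldr (λ a acc → a ℚ.+ (+ n ℚ./ 1) ℚ.* acc) ℚ.0ℚ p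

toℚ : ℤ → ℚ
toℚ z = z ℚ./ 1

sumChars : ∀ d → List (Weight d × ℤ) → FormalChar d
sumChars d m = concatMap (λ lc → scaleC (proj₂ lc) (chH d (proj₁ lc))) m

{-# OPTIONS --safe #-}
-- Write N = d(d-1)/2 and s = ∏_{k<d} k!.  Summing the Gelfand–Tsetlin branching rule that defines chH over
-- the box of interlacing patterns, row by row inside a determinant of falling factorials, and telescoping
-- gives the Weyl dimension formula s · dim H⁰(λ) = ± Vandermonde(λ + ρ).  For x - ρ dominant, s · dim H⁰(n x)
-- is therefore a polynomial in n of degree N with leading coefficient ± Vandermonde(x) = s · dim H⁰(x - ρ).
-- Hence, multiplied by s^e, both terms of the difference are polynomials of degree e N, with leading
-- coefficients s^e ∏ dim H⁰(μᵢ - ρ) and s^e Σ m(λ,μ) dim H⁰(λ) dim H⁰(0)^(e-1); these agree by taking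
-- dimensions in the character identity.  Since each μᵢ is regular, Σ dim G/P_{μᵢ} = e N.
module Submission where

open import Defs
open import Data.Nat as ℕ using (ℕ; zero; suc; _≤_; _∸_; _⊔_; z≤n; s≤s)
import Data.Nat.Properties as ℕP
open import Data.Integer as ℤ using (ℤ; _-_; _*_; _+_; +_; -_; _^_; 0ℤ; 1ℤ)
import Data.Integer.Properties as ℤP
open import Data.Integer.Tactic.RingSolver using (solve-∀)
open import Data.Fin as Fin using (Fin; zero; suc; toℕ; punchIn; punchOut)
import Data.Fin.Properties as FinP
open import Data.Vec as Vec using (Vec; []; _∷_; lookup; toList)
import Data.Vec.Functional as VecF
import Data.Vec.Properties as VecP
open import Data.Vec.Properties using (≡-dec)
open import Data.List as List using (List; []; _∷_; map; concatMap; foldr; upTo; applyUpTo; _++_; length; replicate; allFin)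
import Data.List.Properties as ListP
open import Data.Unit using (⊤; tt)
open import Data.List.Relation.Unary.All using (All; []; _∷_)
open import Data.Rational as ℚ using (ℚ)
import Data.Rational.Properties as ℚP
open import Data.Rational.Unnormalised as ℚᵘ using (mkℚᵘ)
import Data.Rational.Unnormalised.Properties as ℚᵘP
open import Data.Nat.ListAction using (sum)
open import Data.Nat.ListAction.Properties using (sum-++)
open import Data.Bool using (true; false; T; _∧_; if_then_else_)
open import Data.Sum using (_⊎_; inj₁; inj₂; [_,_]′)
open import Data.Product using (Σ; _×_; _,_; proj₁; proj₂)
open import Data.Empty using (⊥-elim)
open import Function using (_∘_)
open import Relation.Nullary using (¬_; yes; no; does)
open import Relation.Nullary.Decidable using (_×-dec_; ¬?)
open import Relation.Binary.PropositionalEquality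

open import Algebra.Properties.Semiring.Sum ℤP.+-*-semiring
  using (sum-syntax; sum-cong-≗; sum-replicate-zero; sum-remove; ∑-distrib-+; ∑-comm; *-distribˡ-sum; *-distribʳ-sum)
  renaming (sum to ∑)
open import Algebra.Properties.Monoid.Sum ℤP.*-1-monoid
  using () renaming (sum to ∏; sum-cong-≗ to ∏-cong)

∑-zero : ∀ {n} {f : Fin n → ℤ} → (∀ i → f i ≡ 0ℤ) → ∑ f ≡ 0ℤ
∑-zero {n} f≗0 = trans (sum-cong-≗ f≗0) (sum-replicate-zero n)

∑-single : ∀ {n} {f : Fin (suc n) → ℤ} (p : Fin (suc n)) → (∀ j → j ≢ p → f j ≡ 0ℤ) → ∑ f ≡ f p
∑-single {f = f} p others = begin
  ∑ f                              ≡⟨ sum-remove {i = p} f ⟩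
  f p + ∑ (λ j → f (punchIn p j))  ≡⟨ cong (λ z → f p + z) (∑-zero λ j → others (punchIn p j) (FinP.punchInᵢ≢i p j)) ⟩
  f p + 0ℤ                         ≡⟨ ℤP.+-identityʳ (f p) ⟩
  f p                              ∎
  where open ≡-Reasoning

Adjacent : ∀ {n} → Fin n → Fin n → Set
Adjacent p q = toℕ q ≡ suc (toℕ p)

Adjacent⇒≢ : ∀ {n} {p q : Fin n} → Adjacent p q → q ≢ p
Adjacent⇒≢ adj refl = ℕP.1+n≢n (sym adj)

∑-cancelling-adjacent-pair : ∀ n (f : Fin n → ℤ) (p q : Fin n) → Adjacent p q →
  (∀ j → j ≢ p → j ≢ q → f j ≡ 0ℤ) → f p + f q ≡ 0ℤ → ∑ f ≡ 0ℤ
∑-cancelling-adjacent-pair (suc (suc n)) f zero (suc zero) _ others pair =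
  trans (sym (ℤP.+-assoc (f zero) (f (suc zero)) _))
        (cong₂ _+_ pair (∑-zero λ i → others (suc (suc i)) (λ ()) (λ ())))
∑-cancelling-adjacent-pair (suc n) f (suc p) (suc q) adj others pair =
  cong₂ _+_ (others zero (λ ()) (λ ()))
    (∑-cancelling-adjacent-pair n (λ i → f (suc i)) p q (ℕP.suc-injective adj)
      (λ j j≢p j≢q → others (suc j) (j≢p ∘ FinP.suc-injective) (j≢q ∘ FinP.suc-injective)) pair)

-- Determinants

Rows : ℕ → ℕ → Set
Rows k n = Fin k → Fin n → ℤ

Matrix : ℕ → Set
Matrix n = Rows n n

updateRow : ∀ {k n} → Rows k n → Fin k → (Fin n → ℤ) → Rows k n
updateRow A r v j c with j Fin.≟ r
... | yes _ = v c
... | no _ = A j c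

updateRow-same : ∀ {k n} (A : Rows k n) r v c → updateRow A r v r c ≡ v c
updateRow-same A r v c with r Fin.≟ r
... | yes _ = refl
... | no r≢r = ⊥-elim (r≢r refl)

updateRow-other : ∀ {k n} (A : Rows k n) r v j → j ≢ r → ∀ c → updateRow A r v j c ≡ A j c
updateRow-other A r v j j≢r c with j Fin.≟ r
... | yes j≡r = ⊥-elim (j≢r j≡r)
... | no _ = refl

sign : ℕ → ℤ
sign zero = 1ℤ
sign (suc k) = - sign k

minor : ∀ {n} → Fin (suc n) → Matrix (suc n) → Matrix n
minor i A r c = A (punchIn i r) (suc c)

det : ∀ n → Matrix n → ℤ
det zero A = 1ℤ
det (suc n) A = ∑[ i < suc n ] (sign (toℕ i) * A i zero * det n (minor i A))

det-cong : ∀ n {A B : Matrix n} → (∀ i j → A i j ≡ B i j) → det n A ≡ det n B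
det-cong zero A≗B = refl
det-cong (suc n) A≗B = sum-cong-≗ λ i →
  cong₂ (λ x y → sign (toℕ i) * x * y) (A≗B i zero) (det-cong n λ r c → A≗B (punchIn i r) (suc c))

det-row-linear : ∀ n (A B C : Matrix n) (r : Fin n) (a b : ℤ) →
  (∀ c → A r c ≡ a * B r c + b * C r c) →
  (∀ j → j ≢ r → ∀ c → A j c ≡ B j c) →
  (∀ j → j ≢ r → ∀ c → A j c ≡ C j c) →
  det n A ≡ a * det n B + b * det n C
det-row-linear (suc n) A B C r a b row-r B-elsewhere C-elsewhere = begin
  ∑[ i < suc n ] term A i                              ≡⟨ sum-cong-≗ term-linear ⟩
  ∑[ i < suc n ] (a * term B i + b * term C i)         ≡⟨ ∑-distrib-+ (λ i → a * term B i) (λ i → b * term C i) ⟩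
  ∑[ i < suc n ] (a * term B i) + ∑[ i < suc n ] (b * term C i)
    ≡⟨ sym (cong₂ _+_ (*-distribˡ-sum a (term B)) (*-distribˡ-sum b (term C))) ⟩
  a * det (suc n) B + b * det (suc n) C                ∎
  where
  open ≡-Reasoning
  term : Matrix (suc n) → Fin (suc n) → ℤ
  term M i = sign (toℕ i) * M i zero * det n (minor i M)
  term-linear : ∀ i → term A i ≡ a * term B i + b * term C i
  term-linear i with i Fin.≟ r
  ... | yes refl = begin
      s * A i zero * det n (minor i A)
    ≡⟨ cong (λ x → s * x * det n (minor i A)) (row-r zero) ⟩
      s * (a * B i zero + b * C i zero) * det n (minor i A)
    ≡⟨ distrib a b s (B i zero) (C i zero) _ ⟩
      a * (s * B i zero * det n (minor i A)) + b * (s * C i zero * det n (minor i A))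
    ≡⟨ cong₂ (λ u v → a * (s * B i zero * u) + b * (s * C i zero * v)) (minor-eq B-elsewhere) (minor-eq C-elsewhere) ⟩
      a * term B i + b * term C i
    ∎
    where
    s : ℤ
    s = sign (toℕ i)
    distrib : ∀ a b s x y d → s * (a * x + b * y) * d ≡ a * (s * x * d) + b * (s * y * d)
    distrib = solve-∀
    minor-eq : ∀ {M} → (∀ j → j ≢ i → ∀ c → A j c ≡ M j c) → det n (minor i A) ≡ det n (minor i M)
    minor-eq elsewhere = det-cong n λ x c → elsewhere (punchIn i x) (FinP.punchInᵢ≢i i x) (suc c)
  ... | no i≢r = begin
      s * A i zero * det n (minor i A)
    ≡⟨ cong (s * A i zero *_) minor-linear ⟩
      s * A i zero * (a * det n (minor i B) + b * det n (minor i C))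
    ≡⟨ distrib a b s (A i zero) _ _ ⟩
      a * (s * A i zero * det n (minor i B)) + b * (s * A i zero * det n (minor i C))
    ≡⟨ cong₂ (λ u v → a * (s * u * det n (minor i B)) + b * (s * v * det n (minor i C)))
         (B-elsewhere i i≢r zero) (C-elsewhere i i≢r zero) ⟩
      a * term B i + b * term C i
    ∎
    where
    s : ℤ
    s = sign (toℕ i)
    distrib : ∀ a b s x dB dC → s * x * (a * dB + b * dC) ≡ a * (s * x * dB) + b * (s * x * dC)
    distrib = solve-∀
    r′ : Fin n
    r′ = punchOut i≢r
    punchIn-r′ : punchIn i r′ ≡ r
    punchIn-r′ = FinP.punchIn-punchOut i≢r
    avoids-r : ∀ x → x ≢ r′ → punchIn i x ≢ r
    avoids-r x x≢r′ eq = x≢r′ (FinP.punchIn-injective i x r′ (trans eq (sym punchIn-r′)))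
    minor-linear : det n (minor i A) ≡ a * det n (minor i B) + b * det n (minor i C)
    minor-linear = det-row-linear n (minor i A) (minor i B) (minor i C) r′ a b
      (λ c → subst (λ z → A z (suc c) ≡ a * B z (suc c) + b * C z (suc c)) (sym punchIn-r′) (row-r (suc c)))
      (λ x x≢r′ c → B-elsewhere (punchIn i x) (avoids-r x x≢r′) (suc c))
      (λ x x≢r′ c → C-elsewhere (punchIn i x) (avoids-r x x≢r′) (suc c))

punchIn-reflects-Adjacent : ∀ {n} (j : Fin (suc n)) {q q′ : Fin n} →
  Adjacent (punchIn j q) (punchIn j q′) → Adjacent q q′
punchIn-reflects-Adjacent zero adj = ℕP.suc-injective adj
punchIn-reflects-Adjacent (suc j) {zero} {zero} ()
punchIn-reflects-Adjacent (suc j) {zero} {suc q′} adj = cong suc (punchIn≡0 j q′ (ℕP.suc-injective adj))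
  where
  punchIn≡0 : ∀ {m} (j : Fin (suc m)) (q : Fin m) → toℕ (punchIn j q) ≡ 0 → toℕ q ≡ 0
  punchIn≡0 zero q ()
  punchIn≡0 (suc j) zero _ = refl
  punchIn≡0 (suc j) (suc q) ()
punchIn-reflects-Adjacent (suc j) {suc q} {zero} ()
punchIn-reflects-Adjacent (suc j) {suc q} {suc q′} adj = cong suc (punchIn-reflects-Adjacent j (ℕP.suc-injective adj))

punchIn-Adjacent : ∀ {n} {p p′ : Fin (suc n)} → Adjacent p p′ → (r : Fin n) →
  punchIn p r ≡ punchIn p′ r ⊎ (punchIn p r ≡ p′ × punchIn p′ r ≡ p)
punchIn-Adjacent {p = zero} {suc zero} _ zero = inj₂ (refl , refl)
punchIn-Adjacent {p = zero} {suc zero} _ (suc r) = inj₁ refl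
punchIn-Adjacent {suc n} {suc p} {suc p′} _ zero = inj₁ refl
punchIn-Adjacent {suc n} {suc p} {suc p′} adj (suc r) with punchIn-Adjacent (ℕP.suc-injective adj) r
... | inj₁ eq = inj₁ (cong suc eq)
... | inj₂ (eq , eq′) = inj₂ (cong suc eq , cong suc eq′)

det-equal-adjacent-rows : ∀ n (A : Matrix n) (p p′ : Fin n) → Adjacent p p′ →
  (∀ c → A p c ≡ A p′ c) → det n A ≡ 0ℤ
det-equal-adjacent-rows (suc n) A p p′ adj rows-equal =
  ∑-cancelling-adjacent-pair (suc n) term p p′ adj other-terms-vanish pair-cancels
  where
  term : Fin (suc n) → ℤ
  term i = sign (toℕ i) * A i zero * det n (minor i A)
  other-terms-vanish : ∀ j → j ≢ p → j ≢ p′ → term j ≡ 0ℤ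
  other-terms-vanish j j≢p j≢p′ =
    trans (cong (sign (toℕ j) * A j zero *_) minor-vanishes) (ℤP.*-zeroʳ (sign (toℕ j) * A j zero))
    where
    q q′ : Fin n
    q = punchOut j≢p
    q′ = punchOut j≢p′
    pq : punchIn j q ≡ p
    pq = FinP.punchIn-punchOut _
    pq′ : punchIn j q′ ≡ p′
    pq′ = FinP.punchIn-punchOut _
    minor-vanishes : det n (minor j A) ≡ 0ℤ
    minor-vanishes = det-equal-adjacent-rows n (minor j A) q q′
      (punchIn-reflects-Adjacent j (subst₂ Adjacent (sym pq) (sym pq′) adj))
      (λ c → subst₂ (λ u v → A u (suc c) ≡ A v (suc c)) (sym pq) (sym pq′) (rows-equal (suc c)))
  same-minor : det n (minor p A) ≡ det n (minor p′ A)
  same-minor = det-cong n λ r c → same-entry r (suc c) (punchIn-Adjacent adj r)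
    where
    same-entry : ∀ r c → punchIn p r ≡ punchIn p′ r ⊎ (punchIn p r ≡ p′ × punchIn p′ r ≡ p) →
                 A (punchIn p r) c ≡ A (punchIn p′ r) c
    same-entry r c (inj₁ eq) = cong (λ u → A u c) eq
    same-entry r c (inj₂ (eq , eq′)) = subst₂ (λ u v → A u c ≡ A v c) (sym eq) (sym eq′) (sym (rows-equal c))
  cancel : ∀ s a d → s * a * d + - s * a * d ≡ 0ℤ
  cancel = solve-∀
  pair-cancels : term p + term p′ ≡ 0ℤ
  pair-cancels = begin
      sign (toℕ p) * A p zero * det n (minor p A) + sign (toℕ p′) * A p′ zero * det n (minor p′ A)
    ≡⟨ cong₂ (λ u v → sign (toℕ p) * A p zero * det n (minor p A) + sign u * v * det n (minor p′ A))
         adj (sym (rows-equal zero)) ⟩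
      sign (toℕ p) * A p zero * det n (minor p A) + - sign (toℕ p) * A p zero * det n (minor p′ A)
    ≡⟨ cong (λ u → sign (toℕ p) * A p zero * det n (minor p A) + - sign (toℕ p) * A p zero * u) (sym same-minor) ⟩
      sign (toℕ p) * A p zero * det n (minor p A) + - sign (toℕ p) * A p zero * det n (minor p A)
    ≡⟨ cancel (sign (toℕ p)) (A p zero) (det n (minor p A)) ⟩
      0ℤ
    ∎
    where open ≡-Reasoning

det-add-adjacent-row : ∀ n (A B : Matrix n) (r s : Fin n) (k : ℤ) → Adjacent r s ⊎ Adjacent s r →
  (∀ c → B r c ≡ A r c + k * A s c) → (∀ j → j ≢ r → ∀ c → B j c ≡ A j c) → det n B ≡ det n A
det-add-adjacent-row n A B r s k adj row-r elsewhere = begin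
  det n B                        ≡⟨ det-row-linear n B A C r 1ℤ k row-r′ elsewhere C-elsewhere ⟩
  1ℤ * det n A + k * det n C     ≡⟨ cong (λ z → 1ℤ * det n A + z) (trans (cong (k *_) C-vanishes) (ℤP.*-zeroʳ k)) ⟩
  1ℤ * det n A + 0ℤ              ≡⟨ trans (ℤP.+-identityʳ _) (ℤP.*-identityˡ _) ⟩
  det n A                        ∎
  where
  open ≡-Reasoning
  C : Matrix n
  C = updateRow A r (A s)
  s≢r : s ≢ r
  s≢r = [ Adjacent⇒≢ , (λ adj′ → Adjacent⇒≢ adj′ ∘ sym) ]′ adj
  row-r′ : ∀ c → B r c ≡ 1ℤ * A r c + k * C r c
  row-r′ c = trans (row-r c) (cong₂ _+_ (sym (ℤP.*-identityˡ (A r c))) (cong (k *_) (sym (updateRow-same A r (A s) c))))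
  C-elsewhere : ∀ j → j ≢ r → ∀ c → B j c ≡ C j c
  C-elsewhere j j≢r c = trans (elsewhere j j≢r c) (sym (updateRow-other A r (A s) j j≢r c))
  C-rows-equal : ∀ c → C r c ≡ C s c
  C-rows-equal c = trans (updateRow-same A r (A s) c) (sym (updateRow-other A r (A s) s s≢r c))
  C-vanishes : det n C ≡ 0ℤ
  C-vanishes = [ (λ r⋖s → det-equal-adjacent-rows n C r s r⋖s C-rows-equal)
               , (λ s⋖r → det-equal-adjacent-rows n C s r s⋖r (sym ∘ C-rows-equal)) ]′ adj

det-expand-first-row : ∀ n (A : Matrix (suc n)) →
  det (suc n) A ≡ ∑[ c < suc n ] (sign (toℕ c) * A zero c * det n (λ r x → A (suc r) (punchIn c x)))
det-expand-first-row zero A = refl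
det-expand-first-row (suc m) A = cong (λ z → sign 0 * A zero zero * det (suc m) (minor zero A) + z) (begin
    ∑[ i < suc m ] (left i * det (suc m) (minor (suc i) A))
  ≡⟨ sum-cong-≗ (λ i → cong (left i *_) (det-expand-first-row m (minor (suc i) A))) ⟩
    ∑[ i < suc m ] (left i * ∑[ c < suc m ] (top′ c * X i c))
  ≡⟨ sum-cong-≗ {suc m} (λ i → *-distribˡ-sum (left i) (λ c → top′ c * X i c)) ⟩
    ∑[ i < suc m ] ∑[ c < suc m ] (left i * (top′ c * X i c))
  ≡⟨ ∑-comm (λ i c → left i * (top′ c * X i c)) ⟩
    ∑[ c < suc m ] ∑[ i < suc m ] (left i * (top′ c * X i c))
  ≡⟨ sum-cong-≗ {suc m} (λ c → sum-cong-≗ {suc m} (λ i →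
       swap-signs (sign (toℕ i)) (A (suc i) zero) (sign (toℕ c)) (A zero (suc c)) (X i c))) ⟩
    ∑[ c < suc m ] ∑[ i < suc m ] (top c * (left′ i * X i c))
  ≡⟨ sum-cong-≗ {suc m} (λ c → sym (*-distribˡ-sum (top c) (λ i → left′ i * X i c))) ⟩
    ∑[ c < suc m ] (top c * ∑[ i < suc m ] (left′ i * X i c))
  ∎)
  where
  open ≡-Reasoning
  left left′ top top′ : Fin (suc m) → ℤ
  left i = sign (suc (toℕ i)) * A (suc i) zero
  left′ i = sign (toℕ i) * A (suc i) zero
  top c = sign (suc (toℕ c)) * A zero (suc c)
  top′ c = sign (toℕ c) * A zero (suc c)
  X : Fin (suc m) → Fin (suc m) → ℤ
  X i c = det m (λ r x → A (suc (punchIn i r)) (suc (punchIn c x)))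
  swap-signs : ∀ si a sc b x → - si * a * (sc * b * x) ≡ - sc * b * (si * a * x)
  swap-signs = solve-∀

_ᵀ : ∀ {n} → Matrix n → Matrix n
(A ᵀ) i j = A j i

det-transpose : ∀ n (A : Matrix n) → det n (A ᵀ) ≡ det n A
det-transpose zero A = refl
det-transpose (suc n) A = trans
  (sum-cong-≗ λ i → cong (sign (toℕ i) * A zero i *_) (det-transpose n (λ r x → A (suc r) (punchIn i x))))
  (sym (det-expand-first-row n A))

det-scale-columns : ∀ n (A : Matrix n) (c : Fin n → ℤ) → det n (λ i j → A i j * c j) ≡ ∏ c * det n A
det-scale-columns zero A c = refl
det-scale-columns (suc n) A c = trans
  (sum-cong-≗ λ i → trans (cong (sign (toℕ i) * (A i zero * c zero) *_) (det-scale-columns n (minor i A) (c ∘ suc)))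
                          (regroup (sign (toℕ i)) (A i zero) (c zero) (∏ (c ∘ suc)) (det n (minor i A))))
  (sym (*-distribˡ-sum (∏ c) (λ i → sign (toℕ i) * A i zero * det n (minor i A))))
  where
  regroup : ∀ s a c₀ P d → s * (a * c₀) * (P * d) ≡ c₀ * P * (s * a * d)
  regroup = solve-∀

det-unit-first-column : ∀ n (A : Matrix (suc n)) (p : Fin (suc n)) →
  A p zero ≡ 1ℤ → (∀ i → i ≢ p → A i zero ≡ 0ℤ) → det (suc n) A ≡ sign (toℕ p) * det n (minor p A)
det-unit-first-column n A p unit zeros = begin
  det (suc n) A                                       ≡⟨ ∑-single p (λ i i≢p → term-vanishes i (zeros i i≢p)) ⟩
  sign (toℕ p) * A p zero * det n (minor p A)         ≡⟨ cong (λ x → sign (toℕ p) * x * det n (minor p A)) unit ⟩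
  sign (toℕ p) * 1ℤ * det n (minor p A)               ≡⟨ cong (_* det n (minor p A)) (ℤP.*-identityʳ (sign (toℕ p))) ⟩
  sign (toℕ p) * det n (minor p A)                    ∎
  where
  open ≡-Reasoning
  term-vanishes : ∀ i → A i zero ≡ 0ℤ → sign (toℕ i) * A i zero * det n (minor i A) ≡ 0ℤ
  term-vanishes i eq rewrite eq | ℤP.*-zeroʳ (sign (toℕ i)) = refl

module _ {n} (a : ℕ → Fin n → ℤ) (κ : ℕ → ℤ) where

  subtractPrevious : ℕ → Fin n → ℤ
  subtractPrevious zero c = a zero c
  subtractPrevious (suc i) c = a (suc i) c - κ i * a i c

  -- The same, applied to the rows i ≥ t only.  Restoring these rows from the top down, each step is a
  -- single row operation against the already restored row above.
  private
    subtractPreviousFrom : ℕ → ℕ → Fin n → ℤ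
    subtractPreviousFrom t zero c = a zero c
    subtractPreviousFrom t (suc i) c with t ℕ.≤? suc i
    ... | yes _ = a (suc i) c - κ i * a i c
    ... | no _ = a (suc i) c

    from-cong : ∀ t t′ i c → (t ≤ i → t′ ≤ i) → (t′ ≤ i → t ≤ i) →
                subtractPreviousFrom t i c ≡ subtractPreviousFrom t′ i c
    from-cong t t′ zero c _ _ = refl
    from-cong t t′ (suc i) c f g with t ℕ.≤? suc i | t′ ℕ.≤? suc i
    ... | yes _ | yes _ = refl
    ... | no _ | no _ = refl
    ... | yes t≤ | no t′≰ = ⊥-elim (t′≰ (f t≤))
    ... | no t≰ | yes t′≤ = ⊥-elim (t≰ (g t′≤))

    from-below : ∀ t i c → i ℕ.< t → subtractPreviousFrom t i c ≡ a i c
    from-below t zero c _ = refl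
    from-below t (suc i) c i<t with t ℕ.≤? suc i
    ... | yes t≤i = ⊥-elim (ℕP.<⇒≱ i<t t≤i)
    ... | no _ = refl

    from-at : ∀ t i c → t ≡ suc i → subtractPreviousFrom t (suc i) c ≡ a (suc i) c - κ i * a i c
    from-at t i c refl with suc i ℕ.≤? suc i
    ... | yes _ = refl
    ... | no i≰i = ⊥-elim (i≰i ℕP.≤-refl)

    from-1 : ∀ i c → subtractPreviousFrom 1 i c ≡ subtractPrevious i c
    from-1 zero c = refl
    from-1 (suc i) c with 1 ℕ.≤? suc i
    ... | yes _ = refl
    ... | no 1≰ = ⊥-elim (1≰ (s≤s z≤n))

    D : ℕ → ℤ
    D t = det n (λ i c → subtractPreviousFrom t (toℕ i) c)

    D-step : ∀ i → D (suc i) ≡ D (suc (suc i))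
    D-step i with suc i ℕ.<? n
    ... | yes i+1<n = det-add-adjacent-row n (λ j c → subtractPreviousFrom (suc (suc i)) (toℕ j) c)
          (λ j c → subtractPreviousFrom (suc i) (toℕ j) c) R S (- κ i) (inj₂ S⋖R) row-R elsewhere
      where
      R S : Fin n
      R = Fin.fromℕ< i+1<n
      S = Fin.fromℕ< (ℕP.<-trans (ℕP.n<1+n i) i+1<n)
      R≡ : toℕ R ≡ suc i
      R≡ = FinP.toℕ-fromℕ< i+1<n
      S≡ : toℕ S ≡ i
      S≡ = FinP.toℕ-fromℕ< _
      S⋖R : Adjacent S R
      S⋖R = trans R≡ (cong suc (sym S≡))
      sub-as-add : ∀ x k y → x - k * y ≡ x + - k * y
      sub-as-add = solve-∀
      row-R : ∀ c → subtractPreviousFrom (suc i) (toℕ R) c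
                  ≡ subtractPreviousFrom (suc (suc i)) (toℕ R) c + - κ i * subtractPreviousFrom (suc (suc i)) (toℕ S) c
      row-R c rewrite R≡ | S≡ =
        trans (from-at (suc i) i c refl)
          (trans (sub-as-add (a (suc i) c) (κ i) (a i c))
            (sym (cong₂ (λ u v → u + - κ i * v) (from-below (suc (suc i)) (suc i) c ℕP.≤-refl)
                                                (from-below (suc (suc i)) i c (ℕP.n≤1+n _)))))
      elsewhere : ∀ j → j ≢ R → ∀ c →
                  subtractPreviousFrom (suc i) (toℕ j) c ≡ subtractPreviousFrom (suc (suc i)) (toℕ j) c
      elsewhere j j≢R c = from-cong (suc i) (suc (suc i)) (toℕ j) c beyond (ℕP.≤-trans (ℕP.n≤1+n _))
        where
        beyond : suc i ≤ toℕ j → suc (suc i) ≤ toℕ j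
        beyond i<j with ℕP.m≤n⇒m<n∨m≡n i<j
        ... | inj₁ lt = lt
        ... | inj₂ eq = ⊥-elim (j≢R (FinP.toℕ-injective (trans (sym eq) (sym R≡))))
    ... | no i+1≮n = det-cong n λ j c → from-cong (suc i) (suc (suc i)) (toℕ j) c
          (λ le → ⊥-elim (i+1≮n (ℕP.≤-<-trans le (FinP.toℕ<n j))))
          (λ le → ⊥-elim (i+1≮n (ℕP.≤-<-trans (ℕP.≤-trans (ℕP.n≤1+n _) le) (FinP.toℕ<n j))))

    D-from-1 : ∀ k → D 1 ≡ D (suc k)
    D-from-1 zero = refl
    D-from-1 (suc k) = trans (D-from-1 k) (D-step k)

  det-subtractPrevious : det n (λ i c → subtractPrevious (toℕ i) c) ≡ det n (λ i c → a (toℕ i) c)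
  det-subtractPrevious = begin
    det n (λ i c → subtractPrevious (toℕ i) c)  ≡⟨ det-cong n (λ i c → sym (from-1 (toℕ i) c)) ⟩
    D 1                                         ≡⟨ D-from-1 n ⟩
    D (suc n)
      ≡⟨ det-cong n (λ i c → from-below (suc n) (toℕ i) c (ℕP.m<n⇒m<1+n (FinP.toℕ<n i))) ⟩
    det n (λ i c → a (toℕ i) c)                 ∎
    where open ≡-Reasoning

infixl 8 _↓_

_↓_ : ℤ → ℕ → ℤ
t ↓ zero = 1ℤ
t ↓ suc i = (t - + i) * t ↓ i

vandermonde : ∀ n → (Fin n → ℤ) → ℤ
vandermonde zero y = 1ℤ
vandermonde (suc n) y = ∏ (λ j → y (suc j) - y zero) * vandermonde n (y ∘ suc)

vandermonde-cong : ∀ n {y y′ : Fin n → ℤ} → (∀ j → y j ≡ y′ j) → vandermonde n y ≡ vandermonde n y′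
vandermonde-cong zero y≗y′ = refl
vandermonde-cong (suc n) y≗y′ =
  cong₂ _*_ (∏-cong λ j → cong₂ _-_ (y≗y′ (suc j)) (y≗y′ zero)) (vandermonde-cong n (y≗y′ ∘ suc))

det-falling-vandermonde : ∀ n (y : Fin n → ℤ) → det n (λ j i → y j ↓ toℕ i) ≡ vandermonde n y
det-falling-vandermonde zero y = refl
det-falling-vandermonde (suc n) y = begin
    det (suc n) (λ j i → y j ↓ toℕ i)
  ≡⟨ sym (det-transpose (suc n) (λ j i → y j ↓ toℕ i)) ⟩
    det (suc n) (λ i j → a (toℕ i) j)
  ≡⟨ sym (det-subtractPrevious a κ) ⟩
    det (suc n) L
  ≡⟨ det-unit-first-column n L zero refl (λ { zero 0≢0 → ⊥-elim (0≢0 refl) ; (suc i) _ → first-column-vanishes i }) ⟩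
    1ℤ * det n (minor zero L)
  ≡⟨ ℤP.*-identityˡ _ ⟩
    det n (minor zero L)
  ≡⟨ det-cong n (λ r c → factor-out-point (y (suc c)) (+ toℕ r) (y (suc c) ↓ toℕ r)) ⟩
    det n (λ r c → y (suc c) ↓ toℕ r * (y (suc c) - y zero))
  ≡⟨ det-scale-columns n (λ r c → y (suc c) ↓ toℕ r) (λ c → y (suc c) - y zero) ⟩
    ∏ (λ c → y (suc c) - y zero) * det n (λ r c → y (suc c) ↓ toℕ r)
  ≡⟨ cong (∏ (λ c → y (suc c) - y zero) *_) (trans (det-transpose n _) (det-falling-vandermonde n (y ∘ suc))) ⟩
    vandermonde (suc n) y
  ∎
  where
  open ≡-Reasoning
  a : ℕ → Fin (suc n) → ℤ
  a i j = y j ↓ i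
  κ : ℕ → ℤ
  κ i = y zero - + i
  L : Matrix (suc n)
  L i j = subtractPrevious a κ (toℕ i) j
  factor-out-point : ∀ t i F → (t - i) * F - (y zero - i) * F ≡ F * (t - y zero)
  factor-out-point t i F = factor t (y zero) i F
    where
    factor : ∀ t y₀ i F → (t - i) * F - (y₀ - i) * F ≡ F * (t - y₀)
    factor = solve-∀
  first-column-vanishes : ∀ i → L (suc i) zero ≡ 0ℤ
  first-column-vanishes i = trans (factor-out-point (y zero) (+ toℕ i) (y zero ↓ toℕ i))
    (trans (cong (y zero ↓ toℕ i *_) (ℤP.+-inverseʳ (y zero))) (ℤP.*-zeroʳ (y zero ↓ toℕ i)))

module _ {n} (a : ℕ → Fin n → ℤ) where

  subtractNextBelow : ℕ → ℕ → Fin n → ℤ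
  subtractNextBelow t i c with i ℕ.<? t
  ... | yes _ = a i c - a (suc i) c
  ... | no _ = a i c

  subtractNextBelow-< : ∀ {t i} c → i ℕ.< t → subtractNextBelow t i c ≡ a i c - a (suc i) c
  subtractNextBelow-< {t} {i} c i<t with i ℕ.<? t
  ... | yes _ = refl
  ... | no i≮t = ⊥-elim (i≮t i<t)

  subtractNextBelow-≮ : ∀ {t i} c → ¬ i ℕ.< t → subtractNextBelow t i c ≡ a i c
  subtractNextBelow-≮ {t} {i} c i≮t with i ℕ.<? t
  ... | yes i<t = ⊥-elim (i≮t i<t)
  ... | no _ = refl

det-subtractNextBelow : ∀ k (a : ℕ → Fin (suc k) → ℤ) t → t ≤ k →
  det (suc k) (λ i c → subtractNextBelow a t (toℕ i) c) ≡ det (suc k) (λ i c → a (toℕ i) c)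
det-subtractNextBelow k a zero _ = det-cong (suc k) λ i c → subtractNextBelow-≮ a {0} {toℕ i} c (λ ())
det-subtractNextBelow k a (suc t) t<k = trans step (det-subtractNextBelow k a t (ℕP.<⇒≤ t<k))
  where
  R S : Fin (suc k)
  R = Fin.fromℕ< (ℕP.<-trans t<k (ℕP.n<1+n k))
  S = Fin.fromℕ< (s≤s t<k)
  R≡ : toℕ R ≡ t
  R≡ = FinP.toℕ-fromℕ< (ℕP.<-trans t<k (ℕP.n<1+n k))
  S≡ : toℕ S ≡ suc t
  S≡ = FinP.toℕ-fromℕ< (s≤s t<k)
  sub-as-add : ∀ x y → x - y ≡ x + - 1ℤ * y
  sub-as-add = solve-∀
  row-R : ∀ c → subtractNextBelow a (suc t) (toℕ R) c
              ≡ subtractNextBelow a t (toℕ R) c + - 1ℤ * subtractNextBelow a t (toℕ S) c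
  row-R c rewrite R≡ | S≡ =
    trans (subtractNextBelow-< a c ℕP.≤-refl)
      (trans (sub-as-add (a t c) (a (suc t) c))
        (sym (cong₂ (λ u v → u + - 1ℤ * v) (subtractNextBelow-≮ a c (ℕP.n≮n t))
                                           (subtractNextBelow-≮ a c (ℕP.n≮n t ∘ ℕP.<-trans (ℕP.n<1+n t))))))
  elsewhere : ∀ j → j ≢ R → ∀ c → subtractNextBelow a (suc t) (toℕ j) c ≡ subtractNextBelow a t (toℕ j) c
  elsewhere j j≢R c with toℕ j ℕ.<? suc t | toℕ j ℕ.<? t
  ... | yes _ | yes _ = refl
  ... | no _ | no _ = refl
  ... | no j≮t+1 | yes j<t = ⊥-elim (j≮t+1 (ℕP.<-trans j<t (ℕP.n<1+n t)))
  ... | yes j<t+1 | no j≮t with ℕP.m≤n⇒m<n∨m≡n (ℕP.≤-pred j<t+1)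
  ...   | inj₁ j<t = ⊥-elim (j≮t j<t)
  ...   | inj₂ j≡t = ⊥-elim (j≢R (FinP.toℕ-injective (trans j≡t (sym R≡))))
  step : det (suc k) (λ i c → subtractNextBelow a (suc t) (toℕ i) c) ≡ det (suc k) (λ i c → subtractNextBelow a t (toℕ i) c)
  step = det-add-adjacent-row (suc k) _ _ R S (- 1ℤ) (inj₁ (trans S≡ (cong suc (sym R≡)))) row-R elsewhere

det-falling-adjacent-differences : ∀ k (y : ℕ → ℤ) →
  det (suc k) (λ j i → y (toℕ j) ↓ toℕ i)
    ≡ sign k * det k (λ j i → y (toℕ j) ↓ suc (toℕ i) - y (suc (toℕ j)) ↓ suc (toℕ i))
det-falling-adjacent-differences k y = begin
    det (suc k) (λ j i → a (toℕ j) i)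
  ≡⟨ sym (det-subtractNextBelow k a k ℕP.≤-refl) ⟩
    det (suc k) B
  ≡⟨ det-unit-first-column k B last last-entry others-vanish ⟩
    sign (toℕ last) * det k (minor last B)
  ≡⟨ cong₂ (λ u v → sign u * v) (FinP.toℕ-fromℕ k) (det-cong k minor-entry) ⟩
    sign k * det k (λ j i → y (toℕ j) ↓ suc (toℕ i) - y (suc (toℕ j)) ↓ suc (toℕ i))
  ∎
  where
  open ≡-Reasoning
  a : ℕ → Fin (suc k) → ℤ
  a j i = y j ↓ toℕ i
  B : Matrix (suc k)
  B j i = subtractNextBelow a k (toℕ j) i
  last : Fin (suc k)
  last = Fin.fromℕ k
  last-entry : B last zero ≡ 1ℤ
  last-entry = subtractNextBelow-≮ a zero (λ lt → ℕP.n≮n k (subst (ℕ._< k) (FinP.toℕ-fromℕ k) lt))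
  others-vanish : ∀ j → j ≢ last → B j zero ≡ 0ℤ
  others-vanish j j≢last = subtractNextBelow-< a zero
    (ℕP.≤∧≢⇒< (ℕP.≤-pred (FinP.toℕ<n j))
              (λ eq → j≢last (FinP.toℕ-injective (trans eq (sym (FinP.toℕ-fromℕ k))))))
  toℕ-punchIn-last : ∀ {m} (r : Fin m) → toℕ (punchIn (Fin.fromℕ m) r) ≡ toℕ r
  toℕ-punchIn-last zero = refl
  toℕ-punchIn-last (suc r) = cong suc (toℕ-punchIn-last r)
  minor-entry : ∀ j i → minor last B j i ≡ y (toℕ j) ↓ suc (toℕ i) - y (suc (toℕ j)) ↓ suc (toℕ i)
  minor-entry j i rewrite toℕ-punchIn-last j = subtractNextBelow-< a (suc i) (FinP.toℕ<n j)

-- Sums over integer ranges and Gelfand–Tsetlin patterns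

sumℤ : List ℤ → ℤ
sumℤ = foldr _+_ 0ℤ

sumℤ-++ : ∀ xs ys → sumℤ (xs ++ ys) ≡ sumℤ xs + sumℤ ys
sumℤ-++ [] ys = sym (ℤP.+-identityˡ _)
sumℤ-++ (x ∷ xs) ys = trans (cong (λ z → x + z) (sumℤ-++ xs ys)) (sym (ℤP.+-assoc x _ _))

sumℤ-map-cong : ∀ {A : Set} (L : List A) {f g : A → ℤ} → (∀ x → f x ≡ g x) → sumℤ (map f L) ≡ sumℤ (map g L)
sumℤ-map-cong L f≗g = cong sumℤ (ListP.map-cong f≗g L)

sumℤ-concatMap : ∀ {A B : Set} (L : List A) (g : A → List B) (f : B → ℤ) →
  sumℤ (map f (concatMap g L)) ≡ sumℤ (map (λ x → sumℤ (map f (g x))) L)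
sumℤ-concatMap [] g f = refl
sumℤ-concatMap (x ∷ L) g f = begin
  sumℤ (map f (g x ++ concatMap g L))                 ≡⟨ cong sumℤ (ListP.map-++ f (g x) (concatMap g L)) ⟩
  sumℤ (map f (g x) ++ map f (concatMap g L))         ≡⟨ sumℤ-++ (map f (g x)) _ ⟩
  sumℤ (map f (g x)) + sumℤ (map f (concatMap g L))   ≡⟨ cong (λ z → sumℤ (map f (g x)) + z) (sumℤ-concatMap L g f) ⟩
  sumℤ (map (λ x → sumℤ (map f (g x))) (x ∷ L))       ∎
  where open ≡-Reasoning

sumℤ-*ˡ : ∀ {A : Set} (L : List A) (c : ℤ) (f : A → ℤ) → sumℤ (map (λ x → c * f x) L) ≡ c * sumℤ (map f L)
sumℤ-*ˡ [] c f = sym (ℤP.*-zeroʳ c)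
sumℤ-*ˡ (x ∷ L) c f = trans (cong (λ z → c * f x + z) (sumℤ-*ˡ L c f)) (sym (ℤP.*-distribˡ-+ c (f x) _))

sumℤ-applyUpTo : ∀ N (h : ℕ → ℕ) (G : ℕ → ℤ) → sumℤ (map G (applyUpTo h N)) ≡ ∑[ m < N ] G (h (toℕ m))
sumℤ-applyUpTo zero h G = refl
sumℤ-applyUpTo (suc N) h G = cong (λ z → G (h 0) + z) (sumℤ-applyUpTo N (h ∘ suc) G)

sumℤ-shifted-upTo : ∀ lo N (f : ℤ → ℤ) → sumℤ (map f (map (λ k → lo + + k) (upTo N))) ≡ ∑[ m < N ] f (lo + + toℕ m)
sumℤ-shifted-upTo lo N f = trans (cong sumℤ (sym (ListP.map-∘ (upTo N)))) (sumℤ-applyUpTo N (λ m → m) (λ m → f (lo + + m)))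

length-rangeℤ : ℤ → ℤ → ℕ
length-rangeℤ lo hi = suc ℤ.∣ hi - lo ∣

sumℤ-rangeℤ : ∀ lo hi (f : ℤ → ℤ) → lo ℤ.≤ hi →
  sumℤ (map f (rangeℤ lo hi)) ≡ ∑[ m < length-rangeℤ lo hi ] f (lo + + toℕ m)
sumℤ-rangeℤ lo hi f lo≤hi with lo ℤ.≤? hi
... | yes _ = sumℤ-shifted-upTo lo (length-rangeℤ lo hi) f
... | no lo≰hi = ⊥-elim (lo≰hi lo≤hi)

lo+∣hi-lo∣≡hi : ∀ lo hi → lo ℤ.≤ hi → lo + + ℤ.∣ hi - lo ∣ ≡ hi
lo+∣hi-lo∣≡hi lo hi lo≤hi =
  trans (cong (λ z → lo + z) (ℤP.0≤i⇒+∣i∣≡i (ℤP.i≤j⇒0≤j-i lo≤hi))) (simplify lo hi)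
  where
  simplify : ∀ lo hi → lo + (hi - lo) ≡ hi
  simplify = solve-∀

sumℤ-rangeℤ-cong : ∀ lo hi {f g : ℤ → ℤ} → (∀ m → lo ℤ.≤ m → m ℤ.≤ hi → f m ≡ g m) →
  sumℤ (map f (rangeℤ lo hi)) ≡ sumℤ (map g (rangeℤ lo hi))
sumℤ-rangeℤ-cong lo hi {f} {g} f≗g with lo ℤ.≤? hi
... | no lo≰hi = refl
... | yes lo≤hi = begin
    sumℤ (map f (map (λ k → lo + + k) (upTo N)))  ≡⟨ sumℤ-shifted-upTo lo N f ⟩
    ∑[ m < N ] f (lo + + toℕ m)                   ≡⟨ sum-cong-≗ {N} in-range ⟩
    ∑[ m < N ] g (lo + + toℕ m)                   ≡⟨ sym (sumℤ-shifted-upTo lo N g) ⟩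
    sumℤ (map g (map (λ k → lo + + k) (upTo N)))  ∎
  where
  open ≡-Reasoning
  N : ℕ
  N = length-rangeℤ lo hi
  in-range : ∀ m → f (lo + + toℕ m) ≡ g (lo + + toℕ m)
  in-range m = f≗g _ (ℤP.i≤i+j lo (+ toℕ m))
    (ℤP.≤-trans (ℤP.+-monoʳ-≤ lo (ℤ.+≤+ (ℕP.≤-pred (FinP.toℕ<n m))))
                (ℤP.≤-reflexive (lo+∣hi-lo∣≡hi lo hi lo≤hi)))

∑-telescope : ∀ N (F : ℕ → ℤ) → ∑[ m < N ] (F (suc (toℕ m)) - F (toℕ m)) ≡ F N - F 0
∑-telescope zero F = sym (ℤP.+-inverseʳ (F 0))
∑-telescope (suc N) F =
  trans (cong (λ z → F 1 - F 0 + z) (∑-telescope N (F ∘ suc))) (collapse (F 0) (F 1) (F (suc N)))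
  where
  collapse : ∀ a b c → b - a + (c - b) ≡ c - a
  collapse = solve-∀

↓-suc : ∀ t i → (t + 1ℤ) ↓ suc i ≡ (t + 1ℤ) * t ↓ i
↓-suc t zero = base t
  where
  base : ∀ t → (t + 1ℤ - 0ℤ) * 1ℤ ≡ (t + 1ℤ) * 1ℤ
  base = solve-∀
↓-suc t (suc i) = trans (cong ((t + 1ℤ - (1ℤ + + i)) *_) (↓-suc t i)) (step t (+ i) (t ↓ i))
  where
  step : ∀ t i F → (t + 1ℤ - (1ℤ + i)) * ((t + 1ℤ) * F) ≡ (t + 1ℤ) * ((t - i) * F)
  step = solve-∀

↓-difference : ∀ t i → (t + 1ℤ) ↓ suc i - t ↓ suc i ≡ t ↓ i * + suc i
↓-difference t i = trans (cong (_- t ↓ suc i) (↓-suc t i)) (factor t (+ i) (t ↓ i))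
  where
  factor : ∀ t i F → (t + 1ℤ) * F - (t - i) * F ≡ F * (1ℤ + i)
  factor = solve-∀

rangeℤ-↓-telescope : ∀ lo hi c i → lo ℤ.≤ hi →
  sumℤ (map (λ a → (a + c) ↓ i) (rangeℤ lo hi)) * + suc i ≡ (hi + c + 1ℤ) ↓ suc i - (lo + c) ↓ suc i
rangeℤ-↓-telescope lo hi c i lo≤hi = begin
    sumℤ (map (λ a → (a + c) ↓ i) (rangeℤ lo hi)) * + suc i
  ≡⟨ cong (_* + suc i) (sumℤ-rangeℤ lo hi (λ a → (a + c) ↓ i) lo≤hi) ⟩
    (∑[ m < N ] ((lo + + toℕ m + c) ↓ i)) * + suc i
  ≡⟨ *-distribʳ-sum {N} (+ suc i) (λ m → (lo + + toℕ m + c) ↓ i) ⟩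
    ∑[ m < N ] ((lo + + toℕ m + c) ↓ i * + suc i)
  ≡⟨ sum-cong-≗ {N} (λ m → trans (cong (λ t → t ↓ i * + suc i) (shift-c (+ toℕ m)))
                                  (sym (trans (cong (λ t → t ↓ suc i - F (toℕ m)) (shift-1 (+ toℕ m)))
                                              (↓-difference (lo + c + + toℕ m) i)))) ⟩
    ∑[ m < N ] (F (suc (toℕ m)) - F (toℕ m))
  ≡⟨ ∑-telescope N F ⟩
    F N - F 0
  ≡⟨ cong₂ (λ u v → u ↓ suc i - v ↓ suc i) ends (ℤP.+-identityʳ (lo + c)) ⟩
    (hi + c + 1ℤ) ↓ suc i - (lo + c) ↓ suc i
  ∎
  where
  open ≡-Reasoning
  N : ℕ
  N = length-rangeℤ lo hi
  F : ℕ → ℤ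
  F m = (lo + c + + m) ↓ suc i
  shift-c : ∀ m → lo + m + c ≡ lo + c + m
  shift-c m = rearrange lo m c
    where
    rearrange : ∀ lo m c → lo + m + c ≡ lo + c + m
    rearrange = solve-∀
  shift-1 : ∀ m → lo + c + (1ℤ + m) ≡ lo + c + m + 1ℤ
  shift-1 m = rearrange lo c m
    where
    rearrange : ∀ lo c m → lo + c + (1ℤ + m) ≡ lo + c + m + 1ℤ
    rearrange = solve-∀
  ends : lo + c + + N ≡ hi + c + 1ℤ
  ends = begin
    lo + c + (1ℤ + + ℤ.∣ hi - lo ∣)    ≡⟨ rearrange lo c (+ ℤ.∣ hi - lo ∣) ⟩
    lo + + ℤ.∣ hi - lo ∣ + c + 1ℤ      ≡⟨ cong (λ z → z + c + 1ℤ) (lo+∣hi-lo∣≡hi lo hi lo≤hi) ⟩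
    hi + c + 1ℤ                        ∎
    where
    rearrange : ∀ lo c d → lo + c + (1ℤ + d) ≡ lo + d + c + 1ℤ
    rearrange = solve-∀

-- Indices out of range give 0.
at : ∀ {n} → Vec ℤ n → ℕ → ℤ
at [] m = 0ℤ
at (x ∷ v) zero = x
at (x ∷ v) (suc m) = at v m

at-lookup : ∀ {n} (v : Vec ℤ n) (j : Fin n) → at v (toℕ j) ≡ lookup v j
at-lookup (x ∷ v) zero = refl
at-lookup (x ∷ v) (suc j) = at-lookup v j

Decreasing : ∀ {n} → Vec ℤ n → Set
Decreasing [] = ⊤
Decreasing (x ∷ []) = ⊤
Decreasing (x ∷ y ∷ r) = y ℤ.≤ x × Decreasing (y ∷ r)

Decreasing-at : ∀ {k} (v : Vec ℤ (suc k)) → Decreasing v → (j : Fin k) → at v (suc (toℕ j)) ℤ.≤ at v (toℕ j)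
Decreasing-at (a ∷ b ∷ r) (b≤a , _) zero = b≤a
Decreasing-at (a ∷ b ∷ r) (_ , dec) (suc j) = Decreasing-at (b ∷ r) dec j

Interlaces : ∀ {k} → Vec ℤ (suc k) → Vec ℤ k → Set
Interlaces (a ∷ []) [] = ⊤
Interlaces (a ∷ b ∷ r) (m ∷ μ) = (b ℤ.≤ m × m ℤ.≤ a) × Interlaces (b ∷ r) μ

Interlaces⇒Decreasing : ∀ {k} (λv : Vec ℤ (suc k)) μ → Interlaces λv μ → Decreasing μ
Interlaces⇒Decreasing (a ∷ []) [] _ = tt
Interlaces⇒Decreasing (a ∷ b ∷ []) (m ∷ []) _ = tt
Interlaces⇒Decreasing (a ∷ b ∷ c ∷ r) (m ∷ m′ ∷ μ) ((b≤m , _) , rest@((_ , m′≤b) , _)) =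
  ℤP.≤-trans m′≤b b≤m , Interlaces⇒Decreasing (b ∷ c ∷ r) (m′ ∷ μ) rest

sumInterlacing : ∀ {k} → Vec ℤ (suc k) → (Vec ℤ k → ℤ) → ℤ
sumInterlacing λv f = sumℤ (map f (interlace λv))

sumInterlacing-∷ : ∀ {k} a b (r : Vec ℤ k) f →
  sumInterlacing (a ∷ b ∷ r) f ≡ sumℤ (map (λ m → sumInterlacing (b ∷ r) (f ∘ (m ∷_))) (rangeℤ b a))
sumInterlacing-∷ a b r f = trans (sumℤ-concatMap (rangeℤ b a) (λ m → map (m ∷_) (interlace (b ∷ r))) f)
  (sumℤ-map-cong (rangeℤ b a) λ m → cong sumℤ (sym (ListP.map-∘ (interlace (b ∷ r)))))

sumInterlacing-cong : ∀ {k} (λv : Vec ℤ (suc k)) {f g : Vec ℤ k → ℤ} →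
  (∀ μ → Interlaces λv μ → f μ ≡ g μ) → sumInterlacing λv f ≡ sumInterlacing λv g
sumInterlacing-cong (a ∷ []) f≗g = cong (_+ 0ℤ) (f≗g [] tt)
sumInterlacing-cong (a ∷ b ∷ r) {f} {g} f≗g = begin
  sumInterlacing (a ∷ b ∷ r) f                                                   ≡⟨ sumInterlacing-∷ a b r f ⟩
  sumℤ (map (λ m → sumInterlacing (b ∷ r) (f ∘ (m ∷_))) (rangeℤ b a))
    ≡⟨ sumℤ-rangeℤ-cong b a (λ m b≤m m≤a →
         sumInterlacing-cong (b ∷ r) λ μ i → f≗g (m ∷ μ) ((b≤m , m≤a) , i)) ⟩
  sumℤ (map (λ m → sumInterlacing (b ∷ r) (g ∘ (m ∷_))) (rangeℤ b a))            ≡⟨ sym (sumInterlacing-∷ a b r g) ⟩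
  sumInterlacing (a ∷ b ∷ r) g                                                   ∎
  where open ≡-Reasoning

-- The interlacing patterns of λ form the box ∏ⱼ [λⱼ₊₁, λⱼ].
interlacingRange : ∀ {k} → Vec ℤ (suc k) → Fin k → List ℤ
interlacingRange λv j = rangeℤ (at λv (suc (toℕ j))) (at λv (toℕ j))

record RowAdditive {k n} (F : Rows k n → ℤ) : Set where
  field
    F-cong : ∀ {R S} → (∀ j i → R j i ≡ S j i) → F R ≡ F S
    F-additive : ∀ R S T r → (∀ i → R r i ≡ S r i + T r i) →
      (∀ j → j ≢ r → ∀ i → R j i ≡ S j i) → (∀ j → j ≢ r → ∀ i → R j i ≡ T j i) → F R ≡ F S + F T
    F-zero-row : ∀ R r → (∀ i → R r i ≡ 0ℤ) → F R ≡ 0ℤ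

det-rowAdditive : ∀ n → RowAdditive (det n)
det-rowAdditive n = record
  { F-cong = det-cong n
  ; F-additive = λ R S T r row-r S-elsewhere T-elsewhere →
      trans (det-row-linear n R S T r 1ℤ 1ℤ
               (λ i → trans (row-r i) (sym (cong₂ _+_ (ℤP.*-identityˡ (S r i)) (ℤP.*-identityˡ (T r i)))))
               S-elsewhere T-elsewhere)
            (cong₂ _+_ (ℤP.*-identityˡ (det n S)) (ℤP.*-identityˡ (det n T)))
  ; F-zero-row = λ R r row-r → det-row-linear n R R R r 0ℤ 0ℤ row-r (λ _ _ _ → refl) (λ _ _ _ → refl)
  }

RowAdditive-∷ : ∀ {k n} {F : Rows (suc k) n → ℤ} → RowAdditive F → (v : Fin n → ℤ) →
  RowAdditive (λ R → F (v VecF.∷ R))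
RowAdditive-∷ F-add v = record
  { F-cong = λ R≗S → F-cong λ { zero i → refl ; (suc j) i → R≗S j i }
  ; F-additive = λ R S T r row-r S-elsewhere T-elsewhere → F-additive (v VecF.∷ R) (v VecF.∷ S) (v VecF.∷ T) (suc r) row-r
      (λ { zero _ i → refl ; (suc j) j≢r i → S-elsewhere j (j≢r ∘ cong suc) i })
      (λ { zero _ i → refl ; (suc j) j≢r i → T-elsewhere j (j≢r ∘ cong suc) i })
  ; F-zero-row = λ R r → F-zero-row (v VecF.∷ R) (suc r)
  }
  where open RowAdditive F-add

RowAdditive-sumℤ : ∀ {k n} {F : Rows k n → ℤ} → RowAdditive F →
  ∀ {A : Set} (R : Rows k n) r (L : List A) (g : A → Fin n → ℤ) →
  (∀ i → R r i ≡ sumℤ (map (λ x → g x i) L)) → F R ≡ sumℤ (map (λ x → F (updateRow R r (g x))) L)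
RowAdditive-sumℤ F-add R r [] g row-r = RowAdditive.F-zero-row F-add R r row-r
RowAdditive-sumℤ {k} {n} {F} F-add R r (x ∷ L) g row-r = begin
    F R
  ≡⟨ F-additive R (updateRow R r (g x)) R′ r
       (λ i → trans (row-r i) (sym (cong₂ _+_ (updateRow-same R r (g x) i) (updateRow-same R r _ i))))
       (λ j j≢r i → sym (updateRow-other R r _ j j≢r i)) (λ j j≢r i → sym (updateRow-other R r _ j j≢r i)) ⟩
    F (updateRow R r (g x)) + F R′
  ≡⟨ cong (λ z → F (updateRow R r (g x)) + z) (RowAdditive-sumℤ F-add R′ r L g (updateRow-same R r _)) ⟩
    F (updateRow R r (g x)) + sumℤ (map (λ y → F (updateRow R′ r (g y))) L)
  ≡⟨ cong (λ z → F (updateRow R r (g x)) + z) (sumℤ-map-cong L λ y → F-cong (overwrite y)) ⟩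
    sumℤ (map (λ y → F (updateRow R r (g y))) (x ∷ L))
  ∎
  where
  open ≡-Reasoning
  open RowAdditive F-add
  R′ : Rows k n
  R′ = updateRow R r (λ i → sumℤ (map (λ y → g y i) L))
  overwrite : ∀ y j i → updateRow R′ r (g y) j i ≡ updateRow R r (g y) j i
  overwrite y j i with j Fin.≟ r
  ... | yes _ = refl
  ... | no j≢r = updateRow-other R r _ j j≢r i

sumInterlacing-RowAdditive : ∀ k {n} {F : Rows k n → ℤ} → RowAdditive F →
  (λv : Vec ℤ (suc k)) (g : Fin k → ℤ → Fin n → ℤ) →
  sumInterlacing λv (λ μ → F (λ j i → g j (lookup μ j) i))
    ≡ F (λ j i → sumℤ (map (λ a → g j a i) (interlacingRange λv j)))
sumInterlacing-RowAdditive zero F-add (a ∷ []) g = trans (ℤP.+-identityʳ _) (RowAdditive.F-cong F-add (λ ()))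
sumInterlacing-RowAdditive (suc k) {n} {F} F-add (a ∷ b ∷ r) g = begin
    sumInterlacing (a ∷ b ∷ r) (λ μ → F (λ j i → g j (lookup μ j) i))
  ≡⟨ sumInterlacing-∷ a b r _ ⟩
    sumℤ (map (λ m → sumInterlacing (b ∷ r) (λ μ → F (λ j i → g j (lookup (m ∷ μ) j) i))) (rangeℤ b a))
  ≡⟨ sumℤ-map-cong (rangeℤ b a) (λ m → trans
       (sumℤ-map-cong (interlace (b ∷ r)) (λ μ → F-cong λ { zero i → refl ; (suc j) i → refl }))
       (sumInterlacing-RowAdditive k (RowAdditive-∷ F-add (g zero m)) (b ∷ r) (g ∘ suc))) ⟩
    sumℤ (map (λ m → F (g zero m VecF.∷ S)) (rangeℤ b a))
  ≡⟨ sym (trans (RowAdditive-sumℤ F-add (first VecF.∷ S) zero (rangeℤ b a) (g zero) (λ i → refl))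
                (sumℤ-map-cong (rangeℤ b a) λ m → F-cong (overwrite-first m))) ⟩
    F (first VecF.∷ S)
  ≡⟨ F-cong (λ { zero i → refl ; (suc j) i → refl }) ⟩
    F (λ j i → sumℤ (map (λ m → g j m i) (interlacingRange (a ∷ b ∷ r) j)))
  ∎
  where
  open ≡-Reasoning
  open RowAdditive F-add
  first : Fin n → ℤ
  first i = sumℤ (map (λ m → g zero m i) (rangeℤ b a))
  S : Rows k n
  S j i = sumℤ (map (λ m → g (suc j) m i) (interlacingRange (b ∷ r) j))
  overwrite-first : ∀ m j i → updateRow (first VecF.∷ S) zero (g zero m) j i ≡ (g zero m VecF.∷ S) j i
  overwrite-first m zero i = updateRow-same (first VecF.∷ S) zero (g zero m) i
  overwrite-first m (suc j) i = updateRow-other (first VecF.∷ S) zero (g zero m) (suc j) (λ ()) i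

-- Characters and their dimensions

dimC-++ : ∀ {d} (χ ψ : FormalChar d) → dimC (χ ++ ψ) ≡ dimC χ + dimC ψ
dimC-++ [] ψ = sym (ℤP.+-identityˡ _)
dimC-++ (x ∷ χ) ψ = trans (cong (λ z → proj₂ x + z) (dimC-++ χ ψ)) (sym (ℤP.+-assoc (proj₂ x) _ _))

dimC-concatMap : ∀ {d} {A : Set} (L : List A) (f : A → FormalChar d) → dimC (concatMap f L) ≡ sumℤ (map (dimC ∘ f) L)
dimC-concatMap [] f = refl
dimC-concatMap (x ∷ L) f = trans (dimC-++ (f x) (concatMap f L)) (cong (λ z → dimC (f x) + z) (dimC-concatMap L f))

dimC-map-weights : ∀ {d d′} (h : Weight d × ℤ → Weight d′) (χ : FormalChar d) →
  dimC (map (λ wc → h wc , proj₂ wc) χ) ≡ dimC χ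
dimC-map-weights h [] = refl
dimC-map-weights h (x ∷ χ) = cong (λ z → proj₂ x + z) (dimC-map-weights h χ)

dimC-map-scaled : ∀ {d} c (h : Weight d × ℤ → Weight d) (χ : FormalChar d) →
  dimC (map (λ wc → h wc , c * proj₂ wc) χ) ≡ c * dimC χ
dimC-map-scaled c h [] = sym (ℤP.*-zeroʳ c)
dimC-map-scaled c h (x ∷ χ) = trans (cong (λ z → c * proj₂ x + z) (dimC-map-scaled c h χ)) (sym (ℤP.*-distribˡ-+ c _ _))

dimC-⊗ : ∀ {d} (χ ψ : FormalChar d) → dimC (χ ⊗ ψ) ≡ dimC χ * dimC ψ
dimC-⊗ [] ψ = refl
dimC-⊗ (a ∷ χ) ψ = trans (dimC-++ (map _ ψ) (χ ⊗ ψ))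
  (trans (cong₂ _+_ (dimC-map-scaled (proj₂ a) (λ b → proj₁ a +w proj₁ b) ψ) (dimC-⊗ χ ψ))
         (sym (ℤP.*-distribʳ-+ (dimC ψ) (proj₂ a) _)))

dimC-⊗-replicate : ∀ {d} k (χ : FormalChar d) → dimC (⊗all (replicate k χ)) ≡ dimC χ ^ k
dimC-⊗-replicate zero χ = refl
dimC-⊗-replicate (suc k) χ = trans (dimC-⊗ χ _) (cong (dimC χ *_) (dimC-⊗-replicate k χ))

dimC-sumChars-∷ : ∀ d λv c (m : List (Weight d × ℤ)) →
  dimC (sumChars d ((λv , c) ∷ m)) ≡ c * dimC (chH d λv) + dimC (sumChars d m)
dimC-sumChars-∷ d λv c m = trans (dimC-++ (scaleC c (chH d λv)) (sumChars d m))
  (cong (_+ dimC (sumChars d m)) (dimC-map-scaled c proj₁ (chH d λv)))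

negateC : ∀ {d} → FormalChar d → FormalChar d
negateC = map (λ wc → proj₁ wc , - proj₂ wc)

coeff-++ : ∀ {d} (χ ψ : FormalChar d) ν → coeff (χ ++ ψ) ν ≡ coeff χ ν + coeff ψ ν
coeff-++ [] ψ ν = sym (ℤP.+-identityˡ _)
coeff-++ (x ∷ χ) ψ ν = trans (cong (λ z → hd + z) (coeff-++ χ ψ ν)) (sym (ℤP.+-assoc hd (coeff χ ν) (coeff ψ ν)))
  where
  hd : ℤ
  hd = if does (≡-dec ℤ._≟_ (proj₁ x) ν) then proj₂ x else 0ℤ

coeff-negateC : ∀ {d} (χ : FormalChar d) ν → coeff (negateC χ) ν ≡ - coeff χ ν
coeff-negateC [] ν = refl
coeff-negateC (x ∷ χ) ν with does (≡-dec ℤ._≟_ (proj₁ x) ν)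
... | true = trans (cong (λ z → - proj₂ x + z) (coeff-negateC χ ν)) (sym (ℤP.neg-distrib-+ (proj₂ x) _))
... | false = trans (cong (λ z → 0ℤ + z) (coeff-negateC χ ν))
                    (trans (ℤP.+-identityˡ (- coeff χ ν)) (cong -_ (sym (ℤP.+-identityˡ (coeff χ ν)))))

dimC-negateC : ∀ {d} (χ : FormalChar d) → dimC (negateC χ) ≡ - dimC χ
dimC-negateC [] = refl
dimC-negateC (x ∷ χ) = trans (cong (λ z → - proj₂ x + z) (dimC-negateC χ)) (sym (ℤP.neg-distrib-+ (proj₂ x) _))

removeWeight : ∀ {d} → Weight d → FormalChar d → FormalChar d
removeWeight w [] = []
removeWeight w (x ∷ χ) with ≡-dec ℤ._≟_ (proj₁ x) w
... | yes _ = removeWeight w χ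
... | no _ = x ∷ removeWeight w χ

dimC-removeWeight : ∀ {d} (w : Weight d) (χ : FormalChar d) → dimC χ ≡ coeff χ w + dimC (removeWeight w χ)
dimC-removeWeight w [] = refl
dimC-removeWeight w (x ∷ χ) with ≡-dec ℤ._≟_ (proj₁ x) w
... | yes _ = trans (cong (λ z → proj₂ x + z) (dimC-removeWeight w χ)) (sym (ℤP.+-assoc (proj₂ x) _ _))
... | no _ = trans (cong (λ z → proj₂ x + z) (dimC-removeWeight w χ)) (regroup (proj₂ x) (coeff χ w) _)
  where
  regroup : ∀ a b c → a + (b + c) ≡ 0ℤ + b + (a + c)
  regroup = solve-∀

coeff-removeWeight-same : ∀ {d} (w : Weight d) (χ : FormalChar d) → coeff (removeWeight w χ) w ≡ 0ℤ
coeff-removeWeight-same w [] = refl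
coeff-removeWeight-same w (x ∷ χ) with ≡-dec ℤ._≟_ (proj₁ x) w
... | yes _ = coeff-removeWeight-same w χ
... | no x≢w with ≡-dec ℤ._≟_ (proj₁ x) w
...   | yes x≡w = ⊥-elim (x≢w x≡w)
...   | no _ = trans (ℤP.+-identityˡ _) (coeff-removeWeight-same w χ)

coeff-removeWeight-other : ∀ {d} (w : Weight d) (χ : FormalChar d) ν → w ≢ ν → coeff (removeWeight w χ) ν ≡ coeff χ ν
coeff-removeWeight-other w [] ν w≢ν = refl
coeff-removeWeight-other w (x ∷ χ) ν w≢ν with ≡-dec ℤ._≟_ (proj₁ x) w
... | yes refl with ≡-dec ℤ._≟_ (proj₁ x) ν
...   | yes x≡ν = ⊥-elim (w≢ν x≡ν)
...   | no _ = trans (coeff-removeWeight-other w χ ν w≢ν) (sym (ℤP.+-identityˡ _))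
coeff-removeWeight-other w (x ∷ χ) ν w≢ν | no _ =
  cong (λ z → (if does (≡-dec ℤ._≟_ (proj₁ x) ν) then proj₂ x else 0ℤ) + z) (coeff-removeWeight-other w χ ν w≢ν)

length-removeWeight : ∀ {d} (w : Weight d) (χ : FormalChar d) → length (removeWeight w χ) ≤ length χ
length-removeWeight w [] = z≤n
length-removeWeight w (x ∷ χ) with ≡-dec ℤ._≟_ (proj₁ x) w
... | yes _ = ℕP.m≤n⇒m≤1+n (length-removeWeight w χ)
... | no _ = s≤s (length-removeWeight w χ)

-- Induction on a bound N for the length, removing all entries of the first weight at each step.
coeff≡0⇒dimC≡0 : ∀ {d} N (χ : FormalChar d) → length χ ≤ N → (∀ ν → coeff χ ν ≡ 0ℤ) → dimC χ ≡ 0ℤ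
coeff≡0⇒dimC≡0 N [] _ _ = refl
coeff≡0⇒dimC≡0 (suc N) (x ∷ χ) (s≤s len) coeffs≡0 = trans (dimC-removeWeight w (x ∷ χ))
  (cong₂ _+_ (coeffs≡0 w) (coeff≡0⇒dimC≡0 N (removeWeight w (x ∷ χ)) shorter remaining≡0))
  where
  w : Weight _
  w = proj₁ x
  shorter : length (removeWeight w (x ∷ χ)) ≤ N
  shorter with ≡-dec ℤ._≟_ w w
  ... | yes _ = ℕP.≤-trans (length-removeWeight w χ) len
  ... | no w≢w = ⊥-elim (w≢w refl)
  remaining≡0 : ∀ ν → coeff (removeWeight w (x ∷ χ)) ν ≡ 0ℤ
  remaining≡0 ν with ≡-dec ℤ._≟_ w ν
  ... | yes refl = coeff-removeWeight-same w (x ∷ χ)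
  ... | no w≢ν = trans (coeff-removeWeight-other w (x ∷ χ) ν w≢ν) (coeffs≡0 ν)

coeff≡⇒dimC≡ : ∀ {d} (χ ψ : FormalChar d) → (∀ ν → coeff χ ν ≡ coeff ψ ν) → dimC χ ≡ dimC ψ
coeff≡⇒dimC≡ χ ψ same = ℤP.i-j≡0⇒i≡j _ _ (begin
    dimC χ - dimC ψ                   ≡⟨ cong (λ z → dimC χ + z) (sym (dimC-negateC ψ)) ⟩
    dimC χ + dimC (negateC ψ)         ≡⟨ sym (dimC-++ χ (negateC ψ)) ⟩
    dimC (χ ++ negateC ψ)             ≡⟨ coeff≡0⇒dimC≡0 _ (χ ++ negateC ψ) ℕP.≤-refl difference≡0 ⟩
    0ℤ                                ∎)
  where
  open ≡-Reasoning
  difference≡0 : ∀ ν → coeff (χ ++ negateC ψ) ν ≡ 0ℤ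
  difference≡0 ν = begin
    coeff (χ ++ negateC ψ) ν        ≡⟨ coeff-++ χ (negateC ψ) ν ⟩
    coeff χ ν + coeff (negateC ψ) ν ≡⟨ cong₂ (λ u v → u + v) (same ν) (coeff-negateC ψ ν) ⟩
    coeff ψ ν - coeff ψ ν           ≡⟨ ℤP.+-inverseʳ (coeff ψ ν) ⟩
    0ℤ                              ∎

dimH : ∀ k → Vec ℤ k → ℤ
dimH k λv = dimC (chH k λv)

dimH-suc : ∀ k (λv : Vec ℤ (suc k)) → dimH (suc k) λv ≡ sumInterlacing λv (dimH k)
dimH-suc k λv = trans (dimC-concatMap (interlace λv) _) (sumℤ-map-cong (interlace λv) λ μ → dimC-map-weights _ (chH k μ))

-- The Weyl dimension formula

superfactorial : ℕ → ℤ
superfactorial zero = 1ℤ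
superfactorial (suc k) = ∏ (λ (i : Fin k) → + suc (toℕ i)) * superfactorial k

weylSign : ℕ → ℤ
weylSign zero = 1ℤ
weylSign (suc k) = sign k * weylSign k

sign-squared : ∀ k → sign k * sign k ≡ 1ℤ
sign-squared zero = refl
sign-squared (suc k) = trans (neg-squared (sign k)) (sign-squared k)
  where
  neg-squared : ∀ x → - x * - x ≡ x * x
  neg-squared = solve-∀

ρat : ℕ → ℕ → ℤ
ρat k m = + (k ∸ 1 ∸ m)

-- The dimension is summed over the interlacing box row by row (the determinant is additive in each row), each
-- row sum telescopes, and the resulting determinant of adjacent differences is the next Weyl determinant.
weyl-determinant : ∀ k (λv : Vec ℤ k) → Decreasing λv →
  superfactorial k * dimH k λv ≡ weylSign k * det k (λ j i → (at λv (toℕ j) + ρat k (toℕ j)) ↓ toℕ i)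
weyl-determinant zero [] _ = refl
weyl-determinant (suc k) λv dec = begin
    P * superfactorial k * dimH (suc k) λv
  ≡⟨ cong (P * superfactorial k *_) (dimH-suc k λv) ⟩
    P * superfactorial k * sumInterlacing λv (dimH k)
  ≡⟨ ℤP.*-assoc P (superfactorial k) _ ⟩
    P * (superfactorial k * sumInterlacing λv (dimH k))
  ≡⟨ cong (P *_) (sym (sumℤ-*ˡ (interlace λv) (superfactorial k) (dimH k))) ⟩
    P * sumInterlacing λv (λ μ → superfactorial k * dimH k μ)
  ≡⟨ cong (P *_) (sumInterlacing-cong λv λ μ i → weyl-determinant k μ (Interlaces⇒Decreasing λv μ i)) ⟩
    P * sumInterlacing λv (λ μ → weylSign k * W k μ)
  ≡⟨ cong (P *_) (sumℤ-*ˡ (interlace λv) (weylSign k) (W k)) ⟩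
    P * (weylSign k * sumInterlacing λv (W k))
  ≡⟨ swap P (weylSign k) _ ⟩
    weylSign k * (P * sumInterlacing λv (W k))
  ≡⟨ cong (λ z → weylSign k * (P * z)) (trans
       (sumℤ-map-cong (interlace λv) λ μ → det-cong k λ j i → cong (λ z → (z + ρat k (toℕ j)) ↓ toℕ i) (at-lookup μ j))
       (sumInterlacing-RowAdditive k (det-rowAdditive k) λv g)) ⟩
    weylSign k * (P * det k (λ j i → sumℤ (map (λ a → g j a i) (interlacingRange λv j))))
  ≡⟨ cong (weylSign k *_) (sym (det-scale-columns k _ (λ i → + suc (toℕ i)))) ⟩
    weylSign k * det k (λ j i → sumℤ (map (λ a → g j a i) (interlacingRange λv j)) * + suc (toℕ i))
  ≡⟨ cong (weylSign k *_) (det-cong k λ j i → column-telescopes k λv dec j (toℕ i)) ⟩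
    weylSign k * D
  ≡⟨ cong (weylSign k *_) (sym (trans (cong (sign k *_) (det-falling-adjacent-differences k y))
       (trans (sym (ℤP.*-assoc (sign k) (sign k) D)) (trans (cong (_* D) (sign-squared k)) (ℤP.*-identityˡ D))))) ⟩
    weylSign k * (sign k * W (suc k) λv)
  ≡⟨ regroup (weylSign k) (sign k) _ ⟩
    weylSign (suc k) * W (suc k) λv
  ∎
  where
  open ≡-Reasoning
  P : ℤ
  P = ∏ (λ (i : Fin k) → + suc (toℕ i))
  W : ∀ k → Vec ℤ k → ℤ
  W k μ = det k (λ j i → (at μ (toℕ j) + ρat k (toℕ j)) ↓ toℕ i)
  y : ℕ → ℤ
  y m = at λv m + ρat (suc k) m
  g : Fin k → ℤ → Fin k → ℤ
  g j a i = (a + ρat k (toℕ j)) ↓ toℕ i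
  D : ℤ
  D = det k (λ j i → y (toℕ j) ↓ suc (toℕ i) - y (suc (toℕ j)) ↓ suc (toℕ i))
  swap : ∀ a b c → a * (b * c) ≡ b * (a * c)
  swap = solve-∀
  regroup : ∀ a b c → a * (b * c) ≡ b * a * c
  regroup = solve-∀
  column-telescopes : ∀ k (λv : Vec ℤ (suc k)) → Decreasing λv → (j : Fin k) (i : ℕ) →
    sumℤ (map (λ a → (a + ρat k (toℕ j)) ↓ i) (interlacingRange λv j)) * + suc i
      ≡ (at λv (toℕ j) + ρat (suc k) (toℕ j)) ↓ suc i - (at λv (suc (toℕ j)) + ρat (suc k) (suc (toℕ j))) ↓ suc i
  column-telescopes (suc k) λv dec j i =
    trans (rangeℤ-↓-telescope (at λv (suc (toℕ j))) (at λv (toℕ j)) (ρat (suc k) (toℕ j)) i (Decreasing-at λv dec j))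
          (cong (λ u → u ↓ suc i - (at λv (suc (toℕ j)) + ρat (suc k) (toℕ j)) ↓ suc i)
                (trans (ℤP.+-assoc (at λv (toℕ j)) _ 1ℤ) (cong (λ z → at λv (toℕ j) + z) top)))
    where
    top : ρat (suc k) (toℕ j) + 1ℤ ≡ ρat (suc (suc k)) (toℕ j)
    top = trans (ℤP.+-comm (ρat (suc k) (toℕ j)) 1ℤ)
                (cong +_ (sym (ℕP.+-∸-assoc 1 (ℕP.≤-pred (FinP.toℕ<n j)))))

Dominant⇒Decreasing : ∀ {n} (v : Vec ℤ n) → Dominant v → Decreasing v
Dominant⇒Decreasing [] _ = tt
Dominant⇒Decreasing (x ∷ []) _ = tt
Dominant⇒Decreasing (x ∷ y ∷ r) dom =
  dom zero (suc zero) z≤n , Dominant⇒Decreasing (y ∷ r) λ i j i≤j → dom (suc i) (suc j) (s≤s i≤j)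

weyl-dimension-formula : ∀ k (λv : Vec ℤ k) → Dominant λv →
  superfactorial k * dimH k λv ≡ weylSign k * vandermonde k (λ j → lookup λv j + lookup (ρ k) j)
weyl-dimension-formula k λv dom = begin
    superfactorial k * dimH k λv
  ≡⟨ weyl-determinant k λv (Dominant⇒Decreasing λv dom) ⟩
    weylSign k * det k (λ j i → (at λv (toℕ j) + ρat k (toℕ j)) ↓ toℕ i)
  ≡⟨ cong (weylSign k *_) (det-falling-vandermonde k (λ j → at λv (toℕ j) + ρat k (toℕ j))) ⟩
    weylSign k * vandermonde k (λ j → at λv (toℕ j) + ρat k (toℕ j))
  ≡⟨ cong (weylSign k *_) (vandermonde-cong k λ j →
       cong₂ _+_ (at-lookup λv j) (sym (VecP.lookup∘tabulate (λ i → + (k ∸ 1 ∸ toℕ i)) j))) ⟩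
    weylSign k * vandermonde k (λ j → lookup λv j + lookup (ρ k) j)
  ∎
  where open ≡-Reasoning

-- Polynomial functions

evalℤ : List ℤ → ℤ → ℤ
evalℤ [] x = 0ℤ
evalℤ (a ∷ p) x = a + x * evalℤ p x

addPoly : List ℤ → List ℤ → List ℤ
addPoly [] q = q
addPoly (a ∷ p) [] = a ∷ p
addPoly (a ∷ p) (b ∷ q) = a + b ∷ addPoly p q

evalℤ-addPoly : ∀ p q x → evalℤ (addPoly p q) x ≡ evalℤ p x + evalℤ q x
evalℤ-addPoly [] q x = sym (ℤP.+-identityˡ _)
evalℤ-addPoly (a ∷ p) [] x = sym (ℤP.+-identityʳ _)
evalℤ-addPoly (a ∷ p) (b ∷ q) x = trans (cong (λ z → a + b + x * z) (evalℤ-addPoly p q x)) (regroup a b x _ _)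
  where
  regroup : ∀ a b x u v → a + b + x * (u + v) ≡ a + x * u + (b + x * v)
  regroup = solve-∀

length-addPoly : ∀ p q → length (addPoly p q) ≤ length p ⊔ length q
length-addPoly [] q = ℕP.≤-refl
length-addPoly (a ∷ p) [] = ℕP.≤-refl
length-addPoly (a ∷ p) (b ∷ q) = s≤s (length-addPoly p q)

evalℤ-scale : ∀ c p x → evalℤ (map (c *_) p) x ≡ c * evalℤ p x
evalℤ-scale c [] x = sym (ℤP.*-zeroʳ c)
evalℤ-scale c (a ∷ p) x = trans (cong (λ z → c * a + x * z) (evalℤ-scale c p x)) (regroup c a x _)
  where
  regroup : ∀ c a x u → c * a + x * (c * u) ≡ c * (a + x * u)
  regroup = solve-∀

mulPoly : List ℤ → List ℤ → List ℤ
mulPoly [] q = []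
mulPoly (a ∷ p) q = addPoly (map (a *_) q) (0ℤ ∷ mulPoly p q)

evalℤ-mulPoly : ∀ p q x → evalℤ (mulPoly p q) x ≡ evalℤ p x * evalℤ q x
evalℤ-mulPoly [] q x = refl
evalℤ-mulPoly (a ∷ p) q x = trans (evalℤ-addPoly (map (a *_) q) (0ℤ ∷ mulPoly p q) x)
  (trans (cong₂ (λ u v → u + (0ℤ + x * v)) (evalℤ-scale a q x) (evalℤ-mulPoly p q x)) (regroup a x _ _))
  where
  regroup : ∀ a x u v → a * v + (0ℤ + x * (u * v)) ≡ (a + x * u) * v
  regroup = solve-∀

length-mulPoly : ∀ p q → length (mulPoly p q) ≤ length p ℕ.+ length q
length-mulPoly [] q = z≤n
length-mulPoly (a ∷ p) q = ℕP.≤-trans (length-addPoly (map (a *_) q) (0ℤ ∷ mulPoly p q))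
  (ℕP.⊔-lub (ℕP.≤-trans (ℕP.≤-reflexive (ListP.length-map (a *_) q)) (ℕP.m≤n+m (length q) (suc (length p))))
            (s≤s (length-mulPoly p q)))

evalℤ-shift : ∀ K p x → evalℤ (replicate K 0ℤ ++ p) x ≡ x ^ K * evalℤ p x
evalℤ-shift zero p x = sym (ℤP.*-identityˡ _)
evalℤ-shift (suc K) p x = trans (cong (λ z → 0ℤ + x * z) (evalℤ-shift K p x)) (regroup x _ _)
  where
  regroup : ∀ x u v → 0ℤ + x * (u * v) ≡ x * u * v
  regroup = solve-∀

length-shift : ∀ K (p : List ℤ) → length (replicate K 0ℤ ++ p) ≡ K ℕ.+ length p
length-shift K p = trans (ListP.length-++ (replicate K 0ℤ)) (cong (ℕ._+ length p) (ListP.length-replicate K))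

DegreeBelow : ℕ → (ℕ → ℤ) → Set
DegreeBelow M f = Σ (List ℤ) λ p → length p ≤ M × (∀ n → f n ≡ evalℤ p (+ n))

DegreeBelow-cong : ∀ {M f g} → (∀ n → f n ≡ g n) → DegreeBelow M f → DegreeBelow M g
DegreeBelow-cong f≗g (p , len , eval) = p , len , λ n → trans (sym (f≗g n)) (eval n)

DegreeBelow-zero : ∀ M → DegreeBelow M (λ _ → 0ℤ)
DegreeBelow-zero M = [] , z≤n , λ _ → refl

DegreeBelow-+ : ∀ {M f g} → DegreeBelow M f → DegreeBelow M g → DegreeBelow M (λ n → f n + g n)
DegreeBelow-+ (p , len , eval) (q , len′ , eval′) = addPoly p q , ℕP.≤-trans (length-addPoly p q) (ℕP.⊔-lub len len′) ,
  λ n → trans (cong₂ _+_ (eval n) (eval′ n)) (sym (evalℤ-addPoly p q (+ n)))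

DegreeBelow-scale : ∀ {M f} c → DegreeBelow M f → DegreeBelow M (λ n → c * f n)
DegreeBelow-scale c (p , len , eval) = map (c *_) p , ℕP.≤-trans (ℕP.≤-reflexive (ListP.length-map (c *_) p)) len ,
  λ n → trans (cong (c *_) (eval n)) (sym (evalℤ-scale c p (+ n)))

DegreeBelow-* : ∀ {M M′ f g} → DegreeBelow M f → DegreeBelow M′ g → DegreeBelow (M ℕ.+ M′) (λ n → f n * g n)
DegreeBelow-* (p , len , eval) (q , len′ , eval′) = mulPoly p q , ℕP.≤-trans (length-mulPoly p q) (ℕP.+-mono-≤ len len′) ,
  λ n → trans (cong₂ _*_ (eval n) (eval′ n)) (sym (evalℤ-mulPoly p q (+ n)))

DegreeBelow-shift : ∀ {M f} K → DegreeBelow M f → DegreeBelow (K ℕ.+ M) (λ n → (+ n) ^ K * f n)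
DegreeBelow-shift K (p , len , eval) =
  replicate K 0ℤ ++ p , ℕP.≤-trans (ℕP.≤-reflexive (length-shift K p)) (ℕP.+-monoʳ-≤ K len) ,
  λ n → trans (cong ((+ n) ^ K *_) (eval n)) (sym (evalℤ-shift K p (+ n)))

-- A record rather than a synonym, so that M, c and f are inferred from its type.
record LeadingTerm (M : ℕ) (c : ℤ) (f : ℕ → ℤ) : Set where
  constructor ⟨_⟩
  field lower-order : DegreeBelow M (λ n → f n - c * (+ n) ^ M)

LeadingTerm-cong : ∀ {M c c′ f g} → (∀ n → f n ≡ g n) → c ≡ c′ → LeadingTerm M c f → LeadingTerm M c′ g
LeadingTerm-cong f≗g refl ⟨ lower ⟩ = ⟨ DegreeBelow-cong (λ n → cong (_- _) (f≗g n)) lower ⟩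

LeadingTerm-zero : ∀ M → LeadingTerm M 0ℤ (λ _ → 0ℤ)
LeadingTerm-zero M = ⟨ DegreeBelow-cong (λ n → sym (cancel ((+ n) ^ M))) (DegreeBelow-zero M) ⟩
  where
  cancel : ∀ P → 0ℤ - 0ℤ * P ≡ 0ℤ
  cancel = solve-∀

LeadingTerm-const : ∀ c → LeadingTerm 0 c (λ _ → c)
LeadingTerm-const c = ⟨ DegreeBelow-cong (λ _ → sym (cancel c)) (DegreeBelow-zero 0) ⟩
  where
  cancel : ∀ c → c - c * 1ℤ ≡ 0ℤ
  cancel = solve-∀

LeadingTerm-linear : ∀ a b → LeadingTerm 1 a (λ n → a * + n + b)
LeadingTerm-linear a b = ⟨ b ∷ [] , ℕP.≤-refl , (λ n → cancel a b (+ n)) ⟩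
  where
  cancel : ∀ a b x → a * x + b - a * (x * 1ℤ) ≡ b + x * 0ℤ
  cancel = solve-∀

LeadingTerm-scale : ∀ {M c f} a → LeadingTerm M c f → LeadingTerm M (a * c) (λ n → a * f n)
LeadingTerm-scale {M} {c} {f} a ⟨ lower ⟩ =
  ⟨ DegreeBelow-cong (λ n → distrib a (f n) c ((+ n) ^ M)) (DegreeBelow-scale a lower) ⟩
  where
  distrib : ∀ a F c P → a * (F - c * P) ≡ a * F - a * c * P
  distrib = solve-∀

LeadingTerm-+ : ∀ {M c c′ f g} → LeadingTerm M c f → LeadingTerm M c′ g → LeadingTerm M (c + c′) (λ n → f n + g n)
LeadingTerm-+ {M} {c} {c′} {f} {g} ⟨ lower ⟩ ⟨ lower′ ⟩ =
  ⟨ DegreeBelow-cong (λ n → regroup (f n) (g n) c c′ ((+ n) ^ M)) (DegreeBelow-+ lower lower′) ⟩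
  where
  regroup : ∀ F G c c′ P → F - c * P + (G - c′ * P) ≡ F + G - (c + c′) * P
  regroup = solve-∀

LeadingTerm-same⇒DegreeBelow : ∀ {M c f g} → LeadingTerm M c f → LeadingTerm M c g → DegreeBelow M (λ n → f n - g n)
LeadingTerm-same⇒DegreeBelow {M} {c} {f} {g} ⟨ lower ⟩ ⟨ lower′ ⟩ =
  DegreeBelow-cong (λ n → regroup (f n) (g n) c ((+ n) ^ M)) (DegreeBelow-+ lower (DegreeBelow-scale (- 1ℤ) lower′))
  where
  regroup : ∀ F G c P → F - c * P + - 1ℤ * (G - c * P) ≡ F - G
  regroup = solve-∀

LeadingTerm-* : ∀ {M M′ c c′ f g} → LeadingTerm M c f → LeadingTerm M′ c′ g →
  LeadingTerm (M ℕ.+ M′) (c * c′) (λ n → f n * g n)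
LeadingTerm-* {M} {M′} {c} {c′} {f} {g} ⟨ lower ⟩ ⟨ lower′ ⟩ = ⟨ DegreeBelow-cong expand
  (DegreeBelow-+ (DegreeBelow-+ (DegreeBelow-scale c (DegreeBelow-shift M lower′))
                               (DegreeBelow-scale c′ (subst (λ K → DegreeBelow K (λ n → (+ n) ^ M′ * (f n - c * (+ n) ^ M)))
                                                     (ℕP.+-comm M′ M) (DegreeBelow-shift M′ lower))))
                 (DegreeBelow-* lower lower′)) ⟩
  where
  expand : ∀ n → c * ((+ n) ^ M * (g n - c′ * (+ n) ^ M′)) + c′ * ((+ n) ^ M′ * (f n - c * (+ n) ^ M))
                   + (f n - c * (+ n) ^ M) * (g n - c′ * (+ n) ^ M′)
               ≡ f n * g n - c * c′ * (+ n) ^ (M ℕ.+ M′)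
  expand n = trans (multiply c c′ (f n) (g n) ((+ n) ^ M) ((+ n) ^ M′))
                   (cong (λ z → f n * g n - c * c′ * z) (sym (ℤP.^-distribˡ-+-* (+ n) M M′)))
    where
    multiply : ∀ c c′ F G P P′ → c * (P * (G - c′ * P′)) + c′ * (P′ * (F - c * P)) + (F - c * P) * (G - c′ * P′)
                               ≡ F * G - c * c′ * (P * P′)
    multiply = solve-∀

LeadingTerm-∏-linear : ∀ k (a b : Fin k → ℤ) → LeadingTerm k (∏ a) (λ n → ∏ (λ j → a j * + n + b j))
LeadingTerm-∏-linear zero a b = LeadingTerm-const 1ℤ
LeadingTerm-∏-linear (suc k) a b =
  LeadingTerm-* (LeadingTerm-linear (a zero) (b zero)) (LeadingTerm-∏-linear k (a ∘ suc) (b ∘ suc))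

numPairs : ℕ → ℕ
numPairs zero = 0
numPairs (suc k) = k ℕ.+ numPairs k

LeadingTerm-vandermonde : ∀ k (x r : Fin k → ℤ) →
  LeadingTerm (numPairs k) (vandermonde k x) (λ n → vandermonde k (λ j → + n * x j + r j))
LeadingTerm-vandermonde zero x r = LeadingTerm-const 1ℤ
LeadingTerm-vandermonde (suc k) x r = LeadingTerm-*
  (LeadingTerm-cong (λ n → ∏-cong λ j → sym (difference (+ n) (x (suc j)) (r (suc j)) (x zero) (r zero))) refl
    (LeadingTerm-∏-linear k (λ j → x (suc j) - x zero) (λ j → r (suc j) - r zero)))
  (LeadingTerm-vandermonde k (x ∘ suc) (r ∘ suc))
  where
  difference : ∀ n x r x₀ r₀ → n * x + r - (n * x₀ + r₀) ≡ (x - x₀) * n + (r - r₀)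
  difference = solve-∀

^-distribʳ-* : ∀ a b k → (a * b) ^ k ≡ a ^ k * b ^ k
^-distribʳ-* a b zero = refl
^-distribʳ-* a b (suc k) = trans (cong (λ z → a * b * z) (^-distribʳ-* a b k)) (regroup a b _ _)
  where
  regroup : ∀ a b P Q → a * b * (P * Q) ≡ a * P * (b * Q)
  regroup = solve-∀

LeadingTerm-^ : ∀ k {N c f} → LeadingTerm N c f → LeadingTerm (k ℕ.* N) (c ^ k) (λ n → f n ^ k)
LeadingTerm-^ zero lead = LeadingTerm-const 1ℤ
LeadingTerm-^ (suc k) lead = LeadingTerm-* lead (LeadingTerm-^ k lead)

-- Dimensions along rays

Dominant-+w : ∀ {d} (u v : Weight d) → Dominant u → Dominant v → Dominant (u +w v)
Dominant-+w u v dom-u dom-v i j i≤j =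
  subst₂ ℤ._≤_ (sym (VecP.lookup-zipWith _+_ j u v)) (sym (VecP.lookup-zipWith _+_ i u v))
    (ℤP.+-mono-≤ (dom-u i j i≤j) (dom-v i j i≤j))

Dominant-·w : ∀ {d} n (u : Weight d) → Dominant u → Dominant (n ·w u)
Dominant-·w n u dom-u i j i≤j =
  subst₂ ℤ._≤_ (sym (VecP.lookup-map j (+ n *_) u)) (sym (VecP.lookup-map i (+ n *_) u))
    (ℤP.*-monoˡ-≤-nonNeg (+ n) (dom-u i j i≤j))

lookup-ρ : ∀ d (i : Fin d) → lookup (ρ d) i ≡ + (d ∸ 1 ∸ toℕ i)
lookup-ρ d = VecP.lookup∘tabulate (λ i → + (d ∸ 1 ∸ toℕ i))

Dominant-ρ : ∀ d → Dominant (ρ d)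
Dominant-ρ d i j i≤j = subst₂ ℤ._≤_ (sym (lookup-ρ d j)) (sym (lookup-ρ d i)) (ℤ.+≤+ (ℕP.∸-monoʳ-≤ (d ∸ 1) i≤j))

Dominant-zeroW : ∀ {d} → Dominant (zeroW {d})
Dominant-zeroW {d} i j _ = subst₂ ℤ._≤_ (sym (VecP.lookup-replicate j 0ℤ)) (sym (VecP.lookup-replicate i 0ℤ)) ℤP.≤-refl

sub-add-cancelʷ : ∀ {d} (x v : Weight d) → (x -w v) +w v ≡ x
sub-add-cancelʷ [] [] = refl
sub-add-cancelʷ (a ∷ x) (b ∷ v) = cong₂ _∷_ (cancel a b) (sub-add-cancelʷ x v)
  where
  cancel : ∀ a b → a - b + b ≡ a
  cancel = solve-∀

add-sub-cancelʷ : ∀ {d} (x v : Weight d) → (x +w v) -w v ≡ x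
add-sub-cancelʷ [] [] = refl
add-sub-cancelʷ (a ∷ x) (b ∷ v) = cong₂ _∷_ (cancel a b) (add-sub-cancelʷ x v)
  where
  cancel : ∀ a b → a + b - b ≡ a
  cancel = solve-∀

sub-selfʷ : ∀ {d} (v : Weight d) → v -w v ≡ zeroW
sub-selfʷ [] = refl
sub-selfʷ (a ∷ v) = cong₂ _∷_ (ℤP.+-inverseʳ a) (sub-selfʷ v)

Dominant-shifted⇒Dominant : ∀ {d} (x : Weight d) → Dominant (x -w ρ d) → Dominant x
Dominant-shifted⇒Dominant {d} x dom = subst Dominant (sub-add-cancelʷ x (ρ d)) (Dominant-+w (x -w ρ d) (ρ d) dom (Dominant-ρ d))

sumInterlacing-zero : ∀ k (f : Vec ℤ k → ℤ) → sumInterlacing (Vec.replicate (suc k) 0ℤ) f ≡ f (Vec.replicate k 0ℤ)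
sumInterlacing-zero zero f = ℤP.+-identityʳ _
sumInterlacing-zero (suc k) f = trans (sumInterlacing-∷ 0ℤ 0ℤ (Vec.replicate k 0ℤ) f)
  (trans (ℤP.+-identityʳ _) (sumInterlacing-zero k (f ∘ (0ℤ ∷_))))

dimH-zero : ∀ k → dimH k zeroW ≡ 1ℤ
dimH-zero zero = refl
dimH-zero (suc k) = trans (dimH-suc k zeroW) (trans (sumInterlacing-zero k (dimH k)) (dimH-zero k))

-- Along the ray n·x the Weyl formula is a polynomial with leading coefficient ± Vandermonde(x), and
-- Vandermonde(x) = Vandermonde((x - ρ) + ρ) is by the Weyl formula again the dimension at x - ρ.
dimH-ray : ∀ d (x : Weight d) → Dominant (x -w ρ d) →
  LeadingTerm (numPairs d) (superfactorial d * dimH d (x -w ρ d)) (λ n → superfactorial d * dimH d (n ·w x))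
dimH-ray d x dom = LeadingTerm-cong on-ray at-shift (LeadingTerm-scale (weylSign d) (LeadingTerm-vandermonde d (lookup x) (lookup (ρ d))))
  where
  on-ray : ∀ n → weylSign d * vandermonde d (λ j → + n * lookup x j + lookup (ρ d) j) ≡ superfactorial d * dimH d (n ·w x)
  on-ray n = sym (trans (weyl-dimension-formula d (n ·w x) (Dominant-·w n x (Dominant-shifted⇒Dominant x dom)))
    (cong (weylSign d *_) (vandermonde-cong d λ j → cong (_+ lookup (ρ d) j) (VecP.lookup-map j (+ n *_) x))))
  at-shift : weylSign d * vandermonde d (lookup x) ≡ superfactorial d * dimH d (x -w ρ d)
  at-shift = sym (trans (weyl-dimension-formula d (x -w ρ d) dom)
    (cong (weylSign d *_) (vandermonde-cong d λ j →
      trans (cong (_+ lookup (ρ d) j) (VecP.lookup-zipWith _-_ j x (ρ d))) (cancel (lookup x j) (lookup (ρ d) j)))))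
    where
    cancel : ∀ a b → a - b + b ≡ a
    cancel = solve-∀

shifted-Dominant⇒distinct : ∀ {d} (x : Weight d) → Dominant (x -w ρ d) →
  ∀ i j → toℕ i ℕ.< toℕ j → lookup x i ≢ lookup x j
shifted-Dominant⇒distinct {d} x dom i j i<j xi≡xj = ℕP.<⇒≱ ρj<ρi (ℤP.drop‿+≤+ ρi≤ρj)
  where
  j≤d-1 : toℕ j ≤ d ∸ 1
  j≤d-1 = ℕP.<⇒≤pred (FinP.toℕ<n j)
  ρj<ρi : d ∸ 1 ∸ toℕ j ℕ.< d ∸ 1 ∸ toℕ i
  ρj<ρi = ℕP.∸-monoʳ-< i<j j≤d-1
  shifted : lookup x j - lookup (ρ d) j ℤ.≤ lookup x j - lookup (ρ d) i
  shifted = subst₂ ℤ._≤_ (VecP.lookup-zipWith _-_ j x (ρ d))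
                         (trans (VecP.lookup-zipWith _-_ i x (ρ d)) (cong (_- lookup (ρ d) i) xi≡xj))
                         (dom i j (ℕP.<⇒≤ i<j))
  cancel : ∀ a b → - a + (a - b) ≡ - b
  cancel = solve-∀
  ρi≤ρj : + (d ∸ 1 ∸ toℕ i) ℤ.≤ + (d ∸ 1 ∸ toℕ j)
  ρi≤ρj = subst₂ ℤ._≤_ (lookup-ρ d i) (lookup-ρ d j)
    (ℤP.neg-cancel-≤ (subst₂ ℤ._≤_ (cancel (lookup x j) _) (cancel (lookup x j) _) (ℤP.+-monoʳ-≤ (- lookup x j) shifted)))

sum-concatMap : ∀ {A : Set} (f : A → List ℕ) (L : List A) → sum (concatMap f L) ≡ sum (map (sum ∘ f) L)
sum-concatMap f [] = refl
sum-concatMap f (a ∷ L) = trans (sum-++ (f a) (concatMap f L)) (cong (sum (f a) ℕ.+_) (sum-concatMap f L))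

sum-tabulate-cong : ∀ d {f g : Fin d → ℕ} → (∀ i → f i ≡ g i) → sum (List.tabulate f) ≡ sum (List.tabulate g)
sum-tabulate-cong d f≗g = cong sum (ListP.tabulate-cong f≗g)

[_<_] : ∀ {d} → Fin d → Fin d → ℕ
[ i < j ] = if does (toℕ i ℕ.<? toℕ j) then 1 else 0

numPairs-tabulate : ∀ d → sum (List.tabulate {n = d} (λ i → sum (List.tabulate {n = d} (λ j → [ i < j ])))) ≡ numPairs d
numPairs-tabulate zero = refl
numPairs-tabulate (suc d) = cong₂ ℕ._+_ (ones d) (numPairs-tabulate d)
  where
  ones : ∀ d → sum (List.tabulate {n = d} (λ _ → 1)) ≡ d
  ones zero = refl
  ones (suc d) = cong suc (ones d)

dimGP-distinct : ∀ {d} (x : Weight d) → (∀ i j → toℕ i ℕ.< toℕ j → lookup x i ≢ lookup x j) → dimGP x ≡ numPairs d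
dimGP-distinct {d} x distinct = begin
    dimGP x
  ≡⟨ sum-concatMap _ (allFin d) ⟩
    sum (map (λ i → sum (map (λ j → indicator i j) (allFin d))) (allFin d))
  ≡⟨ sum-allFin (λ i → sum (map (λ j → indicator i j) (allFin d))) ⟩
    sum (List.tabulate (λ i → sum (map (λ j → indicator i j) (allFin d))))
  ≡⟨ sum-tabulate-cong d (λ i → trans (sum-allFin (indicator i)) (sum-tabulate-cong d (pair-counted i))) ⟩
    sum (List.tabulate {n = d} (λ i → sum (List.tabulate {n = d} (λ j → [ i < j ]))))
  ≡⟨ numPairs-tabulate d ⟩
    numPairs d
  ∎
  where
  open ≡-Reasoning
  sum-allFin : (g : Fin d → ℕ) → sum (map g (allFin d)) ≡ sum (List.tabulate g)
  sum-allFin g = cong sum (ListP.map-tabulate (λ i → i) g)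
  indicator : Fin d → Fin d → ℕ
  indicator i j = if does ((toℕ i ℕ.<? toℕ j) ×-dec ¬? (lookup x i ℤ.≟ lookup x j)) then 1 else 0
  pair-counted : ∀ i j → indicator i j ≡ [ i < j ]
  pair-counted i j with lookup x i ℤ.≟ lookup x j
  ... | no _ = ∧-true (toℕ i ℕ.<ᵇ toℕ j)
    where
    ∧-true : ∀ b → (if b ∧ true then 1 else 0) ≡ (if b then 1 else 0)
    ∧-true true = refl
    ∧-true false = refl
  ... | yes xi≡xj with toℕ i ℕ.<ᵇ toℕ j in i<ᵇj
  ...   | true = ⊥-elim (distinct i j (ℕP.<ᵇ⇒< (toℕ i) (toℕ j) (subst T (sym i<ᵇj) tt)) xi≡xj)
  ...   | false = refl

tensor-dimension-LeadingTerm : ∀ d {k} (μ : Vec (Weight d) k) → ((i : Fin k) → Dominant (lookup μ i -w ρ d)) →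
  LeadingTerm (k ℕ.* numPairs d) (superfactorial d ^ k * dimC (⊗all (map (λ x → chH d (x -w ρ d)) (toList μ))))
                                 (λ n → superfactorial d ^ k * dimC (⊗all (map (λ x → chH d (n ·w x)) (toList μ))))
tensor-dimension-LeadingTerm d [] _ = LeadingTerm-const 1ℤ
tensor-dimension-LeadingTerm d {suc k} (x ∷ μ) dom = LeadingTerm-cong (λ n → regroup (λ x → n ·w x)) (regroup (_-w ρ d))
  (LeadingTerm-* (dimH-ray d x (dom zero)) (tensor-dimension-LeadingTerm d μ (dom ∘ suc)))
  where
  sf : ℤ
  sf = superfactorial d
  regroup : (f : Weight d → Weight d) →
    sf * dimH d (f x) * (sf ^ k * dimC (⊗all (map (λ y → chH d (f y)) (toList μ))))
      ≡ sf ^ suc k * dimC (⊗all (map (λ y → chH d (f y)) (toList (x ∷ μ))))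
  regroup f = trans (rearrange sf (sf ^ k) (dimH d (f x)) _)
                    (cong (λ z → sf ^ suc k * z) (sym (dimC-⊗ (chH d (f x)) (⊗all (map (λ y → chH d (f y)) (toList μ))))))
    where
    rearrange : ∀ s P a b → s * a * (P * b) ≡ s * P * (a * b)
    rearrange = solve-∀

-- The subtracted sum of the theorem, with e here standing for its e ∸ 1.
correction : ∀ d → ℕ → List (Weight d × ℤ) → ℕ → ℤ
correction d e m n = foldr (λ lc acc → proj₂ lc * dimH d (n ·w (proj₁ lc +w ρ d))
                                       * dimC (⊗all (replicate e (chH d (n ·w ρ d)))) + acc) 0ℤ m

correction-LeadingTerm : ∀ d e (m : List (Weight d × ℤ)) → All (λ lc → Dominant (proj₁ lc)) m →
  LeadingTerm (suc e ℕ.* numPairs d) (superfactorial d ^ suc e * dimC (sumChars d m))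
                                     (λ n → superfactorial d ^ suc e * correction d e m n)
correction-LeadingTerm d e [] [] =
  LeadingTerm-cong (λ _ → sym (ℤP.*-zeroʳ S)) (sym (ℤP.*-zeroʳ S)) (LeadingTerm-zero _)
  where
  S : ℤ
  S = superfactorial d ^ suc e
correction-LeadingTerm d e ((λv , c) ∷ m) (dom ∷ doms) = LeadingTerm-cong
  (λ n → trans (cong (_+ S * correction d e m n) (term-value n)) (sym (ℤP.*-distribˡ-+ S _ _)))
  (trans (cong (_+ S * dimC (sumChars d m)) coefficient)
         (trans (sym (ℤP.*-distribˡ-+ S _ _)) (cong (λ z → S * z) (sym (dimC-sumChars-∷ d λv c m)))))
  (LeadingTerm-+ term (correction-LeadingTerm d e m doms))
  where
  sf S : ℤ
  sf = superfactorial d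
  S = sf ^ suc e
  term : LeadingTerm (numPairs d ℕ.+ e ℕ.* numPairs d)
                     (c * (sf * dimH d ((λv +w ρ d) -w ρ d) * (sf * dimH d (ρ d -w ρ d)) ^ e))
                     (λ n → c * (sf * dimH d (n ·w (λv +w ρ d)) * (sf * dimH d (n ·w ρ d)) ^ e))
  term = LeadingTerm-scale c (LeadingTerm-* (dimH-ray d (λv +w ρ d) (subst Dominant (sym (add-sub-cancelʷ λv (ρ d))) dom))
                                            (LeadingTerm-^ e (dimH-ray d (ρ d) (subst Dominant (sym (sub-selfʷ (ρ d))) Dominant-zeroW))))
  rearrange : ∀ s P c a b → c * (s * a * (P * b)) ≡ s * P * (c * a * b)
  rearrange = solve-∀
  term-value : ∀ n → c * (sf * dimH d (n ·w (λv +w ρ d)) * (sf * dimH d (n ·w ρ d)) ^ e)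
                       ≡ S * (c * dimH d (n ·w (λv +w ρ d)) * dimC (⊗all (replicate e (chH d (n ·w ρ d)))))
  term-value n = begin
      c * (sf * dimH d (n ·w (λv +w ρ d)) * (sf * dimH d (n ·w ρ d)) ^ e)
    ≡⟨ cong (λ z → c * (sf * dimH d (n ·w (λv +w ρ d)) * z)) (^-distribʳ-* sf (dimH d (n ·w ρ d)) e) ⟩
      c * (sf * dimH d (n ·w (λv +w ρ d)) * (sf ^ e * dimH d (n ·w ρ d) ^ e))
    ≡⟨ rearrange sf (sf ^ e) c _ _ ⟩
      S * (c * dimH d (n ·w (λv +w ρ d)) * dimH d (n ·w ρ d) ^ e)
    ≡⟨ cong (λ z → S * (c * dimH d (n ·w (λv +w ρ d)) * z)) (sym (dimC-⊗-replicate e (chH d (n ·w ρ d)))) ⟩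
      S * (c * dimH d (n ·w (λv +w ρ d)) * dimC (⊗all (replicate e (chH d (n ·w ρ d)))))
    ∎
    where open ≡-Reasoning
  coefficient : c * (sf * dimH d ((λv +w ρ d) -w ρ d) * (sf * dimH d (ρ d -w ρ d)) ^ e) ≡ S * (c * dimH d λv)
  coefficient = begin
      c * (sf * dimH d ((λv +w ρ d) -w ρ d) * (sf * dimH d (ρ d -w ρ d)) ^ e)
    ≡⟨ cong₂ (λ u v → c * (sf * dimH d u * (sf * v) ^ e)) (add-sub-cancelʷ λv (ρ d))
             (trans (cong (dimH d) (sub-selfʷ (ρ d))) (dimH-zero d)) ⟩
      c * (sf * dimH d λv * (sf * 1ℤ) ^ e)
    ≡⟨ cong (λ z → c * (sf * dimH d λv * z ^ e)) (ℤP.*-identityʳ sf) ⟩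
      c * (sf * dimH d λv * sf ^ e)
    ≡⟨ rearrange′ sf (sf ^ e) c (dimH d λv) ⟩
      S * (c * dimH d λv)
    ∎
    where
    open ≡-Reasoning
    rearrange′ : ∀ s P c a → c * (s * a * P) ≡ s * P * (c * a)
    rearrange′ = solve-∀

IsPositive : ℤ → Set
IsPositive z = Σ ℕ λ s → z ≡ + suc s

*-positive : ∀ {a b} → IsPositive a → IsPositive b → IsPositive (a * b)
*-positive (_ , refl) (_ , refl) = _ , refl

^-positive : ∀ {a} k → IsPositive a → IsPositive (a ^ k)
^-positive zero _ = 0 , refl
^-positive (suc k) pos = *-positive pos (^-positive k pos)

∏-positive : ∀ {k} (f : Fin k → ℤ) → (∀ i → IsPositive (f i)) → IsPositive (∏ f)
∏-positive {zero} f _ = 0 , refl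
∏-positive {suc k} f pos = *-positive (pos zero) (∏-positive (f ∘ suc) (pos ∘ suc))

superfactorial-positive : ∀ k → IsPositive (superfactorial k)
superfactorial-positive zero = 0 , refl
superfactorial-positive (suc k) =
  *-positive (∏-positive (λ (i : Fin k) → + suc (toℕ i)) (λ i → toℕ i , refl)) (superfactorial-positive k)

as-fraction : ∀ z → ℚ.toℚᵘ (toℚ z) ℚᵘ.≃ mkℚᵘ z 0
as-fraction z = ℚP.toℚᵘ-fromℚᵘ (mkℚᵘ z 0)

toℚ-+ : ∀ a b → toℚ (a + b) ≡ toℚ a ℚ.+ toℚ b
toℚ-+ a b = ℚP.toℚᵘ-injective (ℚᵘP.≃-trans (as-fraction (a + b))
  (ℚᵘP.≃-trans (ℚᵘ.*≡* (clear-denominators a b))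
    (ℚᵘP.≃-sym (ℚᵘP.≃-trans (ℚP.toℚᵘ-homo-+ (toℚ a) (toℚ b)) (ℚᵘP.+-cong (as-fraction a) (as-fraction b))))))
  where
  clear-denominators : ∀ a b → (a + b) * 1ℤ ≡ (a * 1ℤ + b * 1ℤ) * 1ℤ
  clear-denominators = solve-∀

toℚ-* : ∀ a b → toℚ (a * b) ≡ toℚ a ℚ.* toℚ b
toℚ-* a b = ℚP.toℚᵘ-injective (ℚᵘP.≃-trans (as-fraction (a * b))
  (ℚᵘP.≃-sym (ℚᵘP.≃-trans (ℚP.toℚᵘ-homo-* (toℚ a) (toℚ b)) (ℚᵘP.*-cong (as-fraction a) (as-fraction b)))))

evalPoly-toℚ : ∀ (r : ℚ) p n → evalPoly (map (λ a → toℚ a ℚ.* r) p) n ≡ toℚ (evalℤ p (+ n)) ℚ.* r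
evalPoly-toℚ r [] n = sym (ℚP.*-zeroˡ r)
evalPoly-toℚ r (a ∷ p) n = begin
    toℚ a ℚ.* r ℚ.+ toℚ (+ n) ℚ.* evalPoly (map (λ a → toℚ a ℚ.* r) p) n
  ≡⟨ cong (λ z → toℚ a ℚ.* r ℚ.+ toℚ (+ n) ℚ.* z) (evalPoly-toℚ r p n) ⟩
    toℚ a ℚ.* r ℚ.+ toℚ (+ n) ℚ.* (toℚ (evalℤ p (+ n)) ℚ.* r)
  ≡⟨ cong (λ z → toℚ a ℚ.* r ℚ.+ z) (sym (ℚP.*-assoc (toℚ (+ n)) _ r)) ⟩
    toℚ a ℚ.* r ℚ.+ toℚ (+ n) ℚ.* toℚ (evalℤ p (+ n)) ℚ.* r
  ≡⟨ sym (ℚP.*-distribʳ-+ r (toℚ a) _) ⟩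
    (toℚ a ℚ.+ toℚ (+ n) ℚ.* toℚ (evalℤ p (+ n))) ℚ.* r
  ≡⟨ cong (ℚ._* r) (sym (trans (toℚ-+ a _) (cong (λ z → toℚ a ℚ.+ z) (toℚ-* (+ n) _)))) ⟩
    toℚ (a + + n * evalℤ p (+ n)) ℚ.* r
  ∎
  where open ≡-Reasoning

DegreeBelow-divide : ∀ {M} (F : ℕ → ℤ) {S} → IsPositive S → DegreeBelow M (λ n → S * F n) →
  Σ (List ℚ) λ p → length p ≤ M × ((n : ℕ) → toℚ (F n) ≡ evalPoly p n)
DegreeBelow-divide {M} F (s , refl) (p , len , eval) =
  map (λ a → toℚ a ℚ.* r) p , subst (_≤ M) (sym (ListP.length-map _ p)) len , λ n → sym (begin
      evalPoly (map (λ a → toℚ a ℚ.* r) p) n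
    ≡⟨ evalPoly-toℚ r p n ⟩
      toℚ (evalℤ p (+ n)) ℚ.* r
    ≡⟨ cong (λ z → toℚ z ℚ.* r) (sym (eval n)) ⟩
      toℚ (S * F n) ℚ.* r
    ≡⟨ cong (ℚ._* r) (trans (toℚ-* S (F n)) (ℚP.*-comm (toℚ S) (toℚ (F n)))) ⟩
      toℚ (F n) ℚ.* toℚ S ℚ.* r
    ≡⟨ ℚP.*-assoc (toℚ (F n)) (toℚ S) r ⟩
      toℚ (F n) ℚ.* (toℚ S ℚ.* r)
    ≡⟨ cong (toℚ (F n) ℚ.*_) (ℚP.*-inverseʳ (toℚ S) {{S≢0}}) ⟩
      toℚ (F n) ℚ.* ℚ.1ℚ
    ≡⟨ ℚP.*-identityʳ (toℚ (F n)) ⟩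
      toℚ (F n)
    ∎)
  where
  open ≡-Reasoning
  S : ℤ
  S = + suc s
  S≢0 : ℚ.NonZero (toℚ S)
  S≢0 = ℚP.pos⇒nonZero (toℚ S) {{ℚP.normalize-pos (suc s) 1}}
  r : ℚ
  r = ℚ.1/_ (toℚ S) {{S≢0}}

sum-dimGP : ∀ {d k} (μ : Vec (Weight d) k) → ((i : Fin k) → Dominant (lookup μ i -w ρ d)) →
  sum (map dimGP (toList μ)) ≡ k ℕ.* numPairs d
sum-dimGP [] _ = refl
sum-dimGP (x ∷ μ) dom = cong₂ ℕ._+_ (dimGP-distinct x (shifted-Dominant⇒distinct x (dom zero))) (sum-dimGP μ (dom ∘ suc))

lemma6p3 : (d e : ℕ) → 1 ≤ e → (μ : Vec (Weight d) e) →
  ((i : Fin e) → Dominant (lookup μ i -w ρ d)) →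
  (m : List (Weight d × ℤ)) → All (λ lc → Dominant (proj₁ lc)) m →
  ((ν : Weight d) → coeff (⊗all (map (λ x → chH d (x -w ρ d)) (toList μ))) ν ≡ coeff (sumChars d m) ν) →
  Σ (List ℚ) (λ p → length p ≤ sum (map dimGP (toList μ)) ×
    ((n : ℕ) → toℚ (dimC (⊗all (map (λ x → chH d (n ·w x)) (toList μ)))
        - foldr (λ lc acc → proj₂ lc * dimC (chH d (n ·w (proj₁ lc +w ρ d)))
                  * dimC (⊗all (replicate (e ∸ 1) (chH d (n ·w ρ d)))) + acc) (+ 0) m)
      ≡ evalPoly p n))
lemma6p3 d (suc e) (s≤s z≤n) μ dom m dom-m same-character =
  let (p , len , eval) = DegreeBelow-divide F (^-positive (suc e) (superfactorial-positive d)) scaled-difference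
  in  p , subst (length p ≤_) (sym (sum-dimGP μ dom)) len , eval
  where
  S : ℤ
  S = superfactorial d ^ suc e
  F : ℕ → ℤ
  F n = dimC (⊗all (map (λ x → chH d (n ·w x)) (toList μ))) - correction d e m n
  same-dimension : dimC (⊗all (map (λ x → chH d (x -w ρ d)) (toList μ))) ≡ dimC (sumChars d m)
  same-dimension = coeff≡⇒dimC≡ (⊗all (map (λ x → chH d (x -w ρ d)) (toList μ))) (sumChars d m) same-character
  distrib : ∀ S a b → S * a - S * b ≡ S * (a - b)
  distrib = solve-∀
  scaled-difference : DegreeBelow (suc e ℕ.* numPairs d) (λ n → S * F n)
  scaled-difference = DegreeBelow-cong (λ n → distrib S _ _) (LeadingTerm-same⇒DegreeBelow
    (tensor-dimension-LeadingTerm d μ dom)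
    (LeadingTerm-cong (λ _ → refl) (cong (S *_) (sym same-dimension)) (correction-LeadingTerm d e m dom-m)))
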